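{- For all integers $n\ge 0$, $A$, $B$, $$f_{(i)}(n+1,A,B)=f_{(i)}(n,A,B)+f_{(i)}(n,A-1,B)+\sum_{j=0}^{A}f_{(i)}(n,A+1,B-j)+\sum_{j=0}^{A-1}f_{(i)}(n,A,B-j).$$
   Context: A marked set partition of $[n]=\{1,\dots,n\}$ is a set partition of $[n]$ with each block marked open or closed; $o(\lambda)$ is its number of open blocks. An arc of $\lambda$ is a pair $(a,b)$, $a<b$, of elements of the same block with no element of that block strictly between them. The intertwining weight of $\lambda$ is the number of pairs of arcs $(a,b),(c,e)$ with $a<c<b<e$, plus the number of pairs (arc $(a,b)$, open block $\mathbf B$) such that $a<\max\mathbf{B}<b$. Let $f_{(i)}(n,A,B)$ be the number of marked set partitions of $[n]$ with $A$ open blocks and intertwining weight $B$ (zero if $A<0$). For $A=0$ the weight is the number of 2-crossings $i(\lambda)$. -}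

module Defs where

open import Data.Nat using (ℕ; zero; suc; _+_; _<ᵇ_; _≡ᵇ_)
open import Data.Bool using (Bool; true; false; _∧_; _∨_; not; if_then_else_)
open import Data.List using (List; []; _∷_; length; filter; map; concatMap; upTo; allFin)
open import Data.Integer using (ℤ; +_; -[1+_])
import Data.Integer as ℤ
open import Data.Product using (_×_; _,_; proj₁; proj₂)
open import Relation.Nullary.Decidable using (⌊_⌋)

countTo : ℕ → (ℕ → Bool) → ℕ
countTo zero    p = 0
countTo (suc m) p = countTo m p + (if p m then 1 else 0)

allTo anyTo : ℕ → (ℕ → Bool) → Bool
allTo zero    p = true
allTo (suc m) p = allTo m p ∧ p m
anyTo zero    p = false
anyTo (suc m) p = anyTo m p ∨ p m

sumTo : ℕ → (ℕ → ℕ) → ℕ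
sumTo zero    g = 0
sumTo (suc m) g = sumTo m g + g m

-- ∑_{j=0}^{A} g j for an integer upper limit A (empty sum if A < 0)
sumZ : ℤ → (ℤ → ℕ) → ℕ
sumZ (+ m)      g = sumTo (suc m) (λ j → g (+ j))
sumZ -[1+ _ ]   g = 0

-- Element k ∈ [n] is represented by the position k-1 ∈ {0,…,n-1}
-- (order preserving).  A set partition is encoded by its (canonical)
-- block-label list ℓ of length n: ℓ[i] is the label of the block
-- containing position i, blocks being labelled 0,1,2,… in order of their
-- minimal elements (restricted growth string).  This encoding is a
-- bijection with set partitions of [n].  The marking is a Bool list
-- mk of length n: block with label j is open iff mk[j] = true; entries at
-- indices j ≥ (number of blocks) are required to be false (canonical).

filterB : {X : Set} → (X → Bool) → List X → List X
filterB p []       = []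
filterB p (x ∷ xs) = if p x then x ∷ filterB p xs else filterB p xs

lists : ℕ → List ℕ → List (List ℕ)
lists zero    xs = [] ∷ []
lists (suc n) xs = concatMap (λ x → map (x ∷_) (lists n xs)) xs

boolLists : ℕ → List (List Bool)
boolLists zero    = [] ∷ []
boolLists (suc n) = concatMap (λ b → map (b ∷_) (boolLists n)) (true ∷ false ∷ [])

-- restricted growth check; k = number of labels used so far
rgfFrom : ℕ → List ℕ → Bool
rgfFrom k []       = true
rgfFrom k (x ∷ xs) = (x <ᵇ suc k) ∧ rgfFrom (if x ≡ᵇ k then suc k else k) xs

isRGF : List ℕ → Bool
isRGF = rgfFrom 0

blocksFrom : ℕ → List ℕ → ℕ
blocksFrom k []       = k
blocksFrom k (x ∷ xs) = blocksFrom (if x ≡ᵇ k then suc k else k) xs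

numBlocks : List ℕ → ℕ
numBlocks = blocksFrom 0

at : List ℕ → ℕ → ℕ
at []       i       = 0
at (x ∷ xs) zero    = x
at (x ∷ xs) (suc i) = at xs i

atB : List Bool → ℕ → Bool
atB []       i       = false
atB (x ∷ xs) zero    = x
atB (x ∷ xs) (suc i) = atB xs i

canonMarks : ℕ → List ℕ → List Bool → Bool
canonMarks n ℓ mk = allTo n (λ j → (j <ᵇ numBlocks ℓ) ∨ not (atB mk j))

MSP : Set
MSP = List ℕ × List Bool

allMSP : ℕ → List MSP
allMSP n = filterB (λ p → isRGF (proj₁ p) ∧ canonMarks n (proj₁ p) (proj₂ p))
                  (concatMap (λ ℓ → map (ℓ ,_) (boolLists n)) (lists n (upTo n)))

isOpen : ℕ → MSP → ℕ → Bool
isOpen n (ℓ , mk) j = (j <ᵇ numBlocks ℓ) ∧ atB mk j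

openBlocks : ℕ → MSP → ℕ
openBlocks n λ' = countTo n (isOpen n λ')

isArc : ℕ → List ℕ → ℕ → ℕ → Bool
isArc n ℓ a b = (a <ᵇ b) ∧ (b <ᵇ n) ∧ (at ℓ a ≡ᵇ at ℓ b)
              ∧ allTo b (λ c → not (a <ᵇ c) ∨ not (at ℓ c ≡ᵇ at ℓ a))

isMaxOf : ℕ → List ℕ → ℕ → ℕ → Bool
isMaxOf n ℓ j i = (i <ᵇ n) ∧ (at ℓ i ≡ᵇ j) ∧ allTo n (λ i' → not (i <ᵇ i') ∨ not (at ℓ i' ≡ᵇ j))

crossings : ℕ → List ℕ → ℕ
crossings n ℓ =
  sumTo n λ a → sumTo n λ b → sumTo n λ c → countTo n λ e →
    isArc n ℓ a b ∧ isArc n ℓ c e ∧ (a <ᵇ c) ∧ (c <ᵇ b) ∧ (b <ᵇ e)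

arcOpen : ℕ → MSP → ℕ
arcOpen n (ℓ , mk) =
  sumTo n λ a → sumTo n λ b → countTo n λ j →
    isArc n ℓ a b ∧ isOpen n (ℓ , mk) j
    ∧ anyTo n (λ i → isMaxOf n ℓ j i ∧ (a <ᵇ i) ∧ (i <ᵇ b))

weight : ℕ → MSP → ℕ
weight n λ' = crossings n (proj₁ λ') + arcOpen n λ'

-- f_(i)(n, A, B): number of marked set partitions of [n] with A open blocks
-- and intertwining weight B (zero whenever A < 0 or B < 0)
fi : ℕ → ℤ → ℤ → ℕ
fi n A B = length (filterB (λ λ' → ⌊ ℤ._≟_ (+ openBlocks n λ') A ⌋ ∧ ⌊ ℤ._≟_ (+ weight n λ') B ⌋) (allMSP n))

-- Every marked partition of [n+1] arises exactly once from a
-- marked partition λ of [n] by putting the new last element either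
--   * into a new singleton block, marked open or closed, or
--   * into an open block x of λ, which then stays open or is closed.
-- A new block changes neither crossings nor arc/open-block pairs.  Joining
-- the open block x adds the arc (max x , n+1); the pairs (arc , block x)
-- that are lost are replaced by exactly as many new crossings, and the
-- new arc pairs with the k open blocks ending after max x, where k (the
-- rank of x) runs through 0,…,o(λ)-1 as x runs through the open blocks.
-- Hence λ with o open blocks and weight w contributes (o, w), (o+1, w),
-- (o, w+k) and (o-1, w+k) for k < o, which are the four terms.
module Submission where

open import Defs
open import Data.Nat using (ℕ; suc; _+_)
open import Data.Integer using (ℤ) renaming (_+_ to _+ℤ_; _-_ to _-ℤ_; 1ℤ to 1ℤ)
open import Relation.Binary.PropositionalEquality using (_≡_)

open import Data.Nat using (zero; pred; _*_; _≤_; _<_; _<ᵇ_; _≡ᵇ_; _≟_; _<?_; z≤n; s≤s)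
open import Data.Nat.Properties
open import Data.Nat.Tactic.RingSolver using (solve-∀)
open import Data.Nat.ListAction using (sum)
open import Data.Nat.ListAction.Properties using (sum-++; sum-↭)
open import Data.Bool using (Bool; true; false; _∧_; _∨_; not; if_then_else_)
import Data.Bool.Properties as Boolₚ
open import Data.Integer as ℤ using (-[1+_]) renaming (+_ to ⁺_)
import Data.Integer.Properties as ℤₚ
open import Data.Product using (_×_; _,_; proj₁; proj₂; ∃-syntax)
open import Data.Sum using (_⊎_; inj₁; inj₂)
open import Data.List using (List; []; _∷_; length; map; concatMap; upTo; applyUpTo; _++_; [_])
open import Data.List.Properties using (∷-injectiveʳ; map-++; upTo-∷ʳ; length-applyUpTo; ∷ʳ-injective)
open import Data.List.Membership.Propositional using (_∈_; find; lose)
open import Data.List.Membership.Propositional.Properties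
  using (∈-map⁺; ∈-map⁻; ∈-concatMap⁺; ∈-concatMap⁻; ∈-upTo⁺; ∈-upTo⁻)
open import Data.List.Membership.Propositional.Properties.WithK using (unique∧set⇒bag)
open import Data.List.Relation.Unary.Any using (here; there)
open import Data.List.Relation.Unary.All as All using (All; []; _∷_)
import Data.List.Relation.Unary.All.Properties as Allₚ
open import Data.List.Relation.Unary.AllPairs using ([]; _∷_)
open import Data.List.Relation.Unary.Unique.Propositional using (Unique)
import Data.List.Relation.Unary.Unique.Propositional.Properties as Uniqueₚ
open import Data.List.Relation.Binary.BagAndSetEquality using (∼bag⇒↭)
import Data.List.Relation.Binary.Permutation.Propositional.Properties as Permₚ
open import Relation.Binary.PropositionalEquality
  using (_≢_; refl; sym; trans; cong; cong₂; subst; module ≡-Reasoning)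
open import Relation.Binary.Definitions using (tri<; tri≈; tri>)
open import Relation.Nullary using (Dec; yes; no)
open import Relation.Nullary.Decidable using (⌊_⌋)
open import Data.Empty using (⊥; ⊥-elim)
open import Function using (case_of_; _∘_; mk⇔; Equivalence)

⟦_⟧ : Bool → ℕ
⟦ b ⟧ = if b then 1 else 0

⟦∧⟧ : ∀ a b → ⟦ a ∧ b ⟧ ≡ ⟦ a ⟧ * ⟦ b ⟧
⟦∧⟧ true  b = sym (+-identityʳ ⟦ b ⟧)
⟦∧⟧ false b = refl

<ᵇ-intro : ∀ {m n} → m < n → (m <ᵇ n) ≡ true
<ᵇ-intro p = Equivalence.to Boolₚ.T-≡ (<⇒<ᵇ p)

<ᵇ-elim : ∀ {m n} → (m <ᵇ n) ≡ true → m < n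
<ᵇ-elim {m} {n} e = <ᵇ⇒< m n (Equivalence.from Boolₚ.T-≡ e)

<ᵇ-false : ∀ {m n} → n ≤ m → (m <ᵇ n) ≡ false
<ᵇ-false {m} {n} p with m <ᵇ n in eq
... | false = refl
... | true  = ⊥-elim (<⇒≱ (<ᵇ-elim eq) p)

≡ᵇ-intro : ∀ {m n} → m ≡ n → (m ≡ᵇ n) ≡ true
≡ᵇ-intro {m} {n} p = Equivalence.to Boolₚ.T-≡ (≡⇒≡ᵇ m n p)

≡ᵇ-elim : ∀ {m n} → (m ≡ᵇ n) ≡ true → m ≡ n
≡ᵇ-elim {m} {n} e = ≡ᵇ⇒≡ m n (Equivalence.from Boolₚ.T-≡ e)

≡ᵇ-false : ∀ {m n} → m ≢ n → (m ≡ᵇ n) ≡ false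
≡ᵇ-false {m} {n} p with m ≡ᵇ n in eq
... | false = refl
... | true  = ⊥-elim (p (≡ᵇ-elim eq))

≡ᵇ-refl : ∀ m → (m ≡ᵇ m) ≡ true
≡ᵇ-refl m = ≡ᵇ-intro {m} refl

∧-elimˡ : ∀ {a b} → (a ∧ b) ≡ true → a ≡ true
∧-elimˡ {true} _ = refl

∧-elimʳ : ∀ {a b} → (a ∧ b) ≡ true → b ≡ true
∧-elimʳ {true} e = e

∧-intro : ∀ {a b} → a ≡ true → b ≡ true → (a ∧ b) ≡ true
∧-intro refl refl = refl

∧-falseˡ : ∀ {a} b → a ≡ false → (a ∧ b) ≡ false
∧-falseˡ b refl = refl

∧-falseʳ : ∀ a {b} → b ≡ false → (a ∧ b) ≡ false
∧-falseʳ a refl = Boolₚ.∧-zeroʳ a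

bool-ext : ∀ {a b : Bool} → (a ≡ true → b ≡ true) → (b ≡ true → a ≡ true) → a ≡ b
bool-ext {false} {false} f g = refl
bool-ext {false} {true}  f g = g refl
bool-ext {true}  {false} f g = sym (f refl)
bool-ext {true}  {true}  f g = refl

sumTo-cong : ∀ N {f g : ℕ → ℕ} → (∀ i → i < N → f i ≡ g i) → sumTo N f ≡ sumTo N g
sumTo-cong zero    h = refl
sumTo-cong (suc N) h = cong₂ _+_ (sumTo-cong N (λ i p → h i (m<n⇒m<1+n p))) (h N (n<1+n N))

countTo-cong : ∀ N {p q : ℕ → Bool} → (∀ i → i < N → p i ≡ q i) → countTo N p ≡ countTo N q
countTo-cong zero    h = refl
countTo-cong (suc N) h =
  cong₂ _+_ (countTo-cong N (λ i p → h i (m<n⇒m<1+n p))) (cong ⟦_⟧ (h N (n<1+n N)))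

allTo-cong : ∀ N {p q : ℕ → Bool} → (∀ i → i < N → p i ≡ q i) → allTo N p ≡ allTo N q
allTo-cong zero    h = refl
allTo-cong (suc N) h = cong₂ _∧_ (allTo-cong N (λ i p → h i (m<n⇒m<1+n p))) (h N (n<1+n N))

anyTo-cong : ∀ N {p q : ℕ → Bool} → (∀ i → i < N → p i ≡ q i) → anyTo N p ≡ anyTo N q
anyTo-cong zero    h = refl
anyTo-cong (suc N) h = cong₂ _∨_ (anyTo-cong N (λ i p → h i (m<n⇒m<1+n p))) (h N (n<1+n N))

countTo-sum : ∀ N (p : ℕ → Bool) → countTo N p ≡ sumTo N (λ i → ⟦ p i ⟧)
countTo-sum zero    p = refl
countTo-sum (suc N) p = cong (_+ ⟦ p N ⟧) (countTo-sum N p)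

sumTo-zero : ∀ N {f : ℕ → ℕ} → (∀ i → i < N → f i ≡ 0) → sumTo N f ≡ 0
sumTo-zero zero    h = refl
sumTo-zero (suc N) h = cong₂ _+_ (sumTo-zero N (λ i p → h i (m<n⇒m<1+n p))) (h N (n<1+n N))

countTo-zero : ∀ N {p : ℕ → Bool} → (∀ i → i < N → p i ≡ false) → countTo N p ≡ 0
countTo-zero N {p} h = trans (countTo-sum N p) (sumTo-zero N (λ i q → cong ⟦_⟧ (h i q)))

sumTo-+ : ∀ N (f g : ℕ → ℕ) → sumTo N (λ i → f i + g i) ≡ sumTo N f + sumTo N g
sumTo-+ zero    f g = refl
sumTo-+ (suc N) f g = trans (cong (_+ (f N + g N)) (sumTo-+ N f g))
                            (shuffle (sumTo N f) (sumTo N g) (f N) (g N))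
  where
  shuffle : ∀ a b c d → a + b + (c + d) ≡ a + c + (b + d)
  shuffle = solve-∀

sumTo-*ˡ : ∀ N c (f : ℕ → ℕ) → sumTo N (λ i → c * f i) ≡ c * sumTo N f
sumTo-*ˡ zero    c f = sym (*-zeroʳ c)
sumTo-*ˡ (suc N) c f =
  trans (cong (_+ c * f N) (sumTo-*ˡ N c f)) (sym (*-distribˡ-+ c (sumTo N f) (f N)))

sumTo-swap : ∀ N M (f : ℕ → ℕ → ℕ) →
             sumTo N (λ i → sumTo M (f i)) ≡ sumTo M (λ j → sumTo N (λ i → f i j))
sumTo-swap zero    M f = sym (sumTo-zero M (λ _ _ → refl))
sumTo-swap (suc N) M f =
  trans (cong (_+ sumTo M (f N)) (sumTo-swap N M f))
        (sym (sumTo-+ M (λ j → sumTo N (λ i → f i j)) (f N)))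

sumTo-shift : ∀ N (f : ℕ → ℕ) → sumTo (suc N) f ≡ f 0 + sumTo N (f ∘ suc)
sumTo-shift zero    f = +-comm 0 (f 0)
sumTo-shift (suc N) f = trans (cong (_+ f (suc N)) (sumTo-shift N f)) (+-assoc (f 0) _ _)

sumTo-single : ∀ N k {f : ℕ → ℕ} → k < N → (∀ i → i < N → i ≢ k → f i ≡ 0) → sumTo N f ≡ f k
sumTo-single (suc N) k {f} k<N h with k ≟ N
... | yes refl =
  cong (_+ f k) (sumTo-zero N (λ i p → h i (m<n⇒m<1+n p) (<⇒≢ p)))
... | no k≢N =
  trans (cong₂ _+_ (sumTo-single N k (≤∧≢⇒< (≤-pred k<N) k≢N) (λ i p → h i (m<n⇒m<1+n p)))
                   (h N (n<1+n N) (k≢N ∘ sym)))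
        (+-identityʳ (f k))

sumTo-dropLast : ∀ N (f : ℕ → ℕ) → f N ≡ 0 → sumTo (suc N) f ≡ sumTo N f
sumTo-dropLast N f e = trans (cong (sumTo N f +_) e) (+-identityʳ _)

countTo-update : ∀ N x c (p : ℕ → Bool) → x < N →
                 countTo N (λ j → if j ≡ᵇ x then c else p j) + ⟦ p x ⟧ ≡ countTo N p + ⟦ c ⟧
countTo-update (suc N) x c p x<N with x ≟ N
... | yes refl =
  trans (cong (λ u → u + ⟦ if x ≡ᵇ x then c else p x ⟧ + ⟦ p x ⟧) away)
        (trans (cong (λ u → countTo x p + ⟦ if u then c else p x ⟧ + ⟦ p x ⟧) (≡ᵇ-refl x))
               (swap₂ (countTo x p) ⟦ c ⟧ ⟦ p x ⟧))
  where
  away : countTo x (λ j → if j ≡ᵇ x then c else p j) ≡ countTo x p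
  away = countTo-cong x (λ j q → cong (λ u → if u then c else p j) (≡ᵇ-false (<⇒≢ q)))
  swap₂ : ∀ u v w → u + v + w ≡ u + w + v
  swap₂ = solve-∀
... | no x≢N =
  trans (cong (λ u → countTo N (λ j → if j ≡ᵇ x then c else p j) + ⟦ if u then c else p N ⟧ + ⟦ p x ⟧)
              (≡ᵇ-false (x≢N ∘ sym)))
  (trans (swap₂ _ ⟦ p N ⟧ ⟦ p x ⟧)
  (trans (cong (_+ ⟦ p N ⟧) (countTo-update N x c p (≤∧≢⇒< (≤-pred x<N) x≢N)))
         (swap₂ (countTo N p) ⟦ c ⟧ ⟦ p N ⟧)))
  where
  swap₂ : ∀ u v w → u + v + w ≡ u + w + v
  swap₂ = solve-∀

allTo-elim : ∀ N {p : ℕ → Bool} → allTo N p ≡ true → ∀ i → i < N → p i ≡ true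
allTo-elim (suc N) {p} e i i<N with i ≟ N
... | yes refl = ∧-elimʳ {allTo N p} e
... | no i≢N   = allTo-elim N (∧-elimˡ e) i (≤∧≢⇒< (≤-pred i<N) i≢N)

allTo-intro : ∀ N {p : ℕ → Bool} → (∀ i → i < N → p i ≡ true) → allTo N p ≡ true
allTo-intro zero    h = refl
allTo-intro (suc N) h = ∧-intro (allTo-intro N (λ i q → h i (m<n⇒m<1+n q))) (h N (n<1+n N))

anyTo-intro : ∀ N {p : ℕ → Bool} i → i < N → p i ≡ true → anyTo N p ≡ true
anyTo-intro (suc N) {p} i i<N e with i ≟ N
... | yes refl = trans (cong (anyTo N p ∨_) e) (Boolₚ.∨-zeroʳ (anyTo N p))
... | no i≢N   = cong (_∨ p N) (anyTo-intro N {p} i (≤∧≢⇒< (≤-pred i<N) i≢N) e)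

anyTo-false : ∀ N {p : ℕ → Bool} → (∀ i → i < N → p i ≡ false) → anyTo N p ≡ false
anyTo-false zero    h = refl
anyTo-false (suc N) h = cong₂ _∨_ (anyTo-false N (λ i q → h i (m<n⇒m<1+n q))) (h N (n<1+n N))

anyTo-count : ∀ N {p : ℕ → Bool} →
              (∀ i j → i < N → j < N → p i ≡ true → p j ≡ true → i ≡ j) →
              ⟦ anyTo N p ⟧ ≡ countTo N p
anyTo-count zero    h = refl
anyTo-count (suc N) {p} h with p N in pN
... | true =
  trans (cong ⟦_⟧ (Boolₚ.∨-zeroʳ (anyTo N p))) (cong (_+ 1) (sym (countTo-zero N {p} earlier)))
  where
  earlier : ∀ i → i < N → p i ≡ false
  earlier i i<N with p i in pi
  ... | false = refl
  ... | true  = ⊥-elim (<⇒≢ i<N (h i N (m<n⇒m<1+n i<N) (n<1+n N) pi pN))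
... | false =
  trans (cong ⟦_⟧ (Boolₚ.∨-identityʳ (anyTo N p)))
        (trans (anyTo-count N (λ i j a b → h i j (m<n⇒m<1+n a) (m<n⇒m<1+n b)))
               (sym (+-identityʳ _)))

sumL : {X : Set} → List X → (X → ℕ) → ℕ
sumL xs f = sum (map f xs)

length-filterB : {X : Set} (p : X → Bool) (xs : List X) →
                 length (filterB p xs) ≡ sumL xs (λ x → ⟦ p x ⟧)
length-filterB p []       = refl
length-filterB p (x ∷ xs) with p x
... | true  = cong suc (length-filterB p xs)
... | false = length-filterB p xs

sumL-filterB : {X : Set} (p : X → Bool) (xs : List X) (f : X → ℕ) →
               sumL (filterB p xs) f ≡ sumL xs (λ x → ⟦ p x ⟧ * f x)
sumL-filterB p []       f = refl
sumL-filterB p (x ∷ xs) f with p x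
... | true  = cong₂ _+_ (sym (+-identityʳ (f x))) (sumL-filterB p xs f)
... | false = sumL-filterB p xs f

sumL-++ : {X : Set} (xs ys : List X) (f : X → ℕ) → sumL (xs ++ ys) f ≡ sumL xs f + sumL ys f
sumL-++ xs ys f = trans (cong sum (map-++ f xs ys)) (sum-++ (map f xs) (map f ys))

sumL-map : {X Y : Set} (g : X → Y) (xs : List X) (f : Y → ℕ) → sumL (map g xs) f ≡ sumL xs (f ∘ g)
sumL-map g []       f = refl
sumL-map g (x ∷ xs) f = cong (f (g x) +_) (sumL-map g xs f)

sumL-concatMap : {X Y : Set} (g : X → List Y) (xs : List X) (f : Y → ℕ) →
                 sumL (concatMap g xs) f ≡ sumL xs (λ x → sumL (g x) f)
sumL-concatMap g []       f = refl
sumL-concatMap g (x ∷ xs) f =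
  trans (sumL-++ (g x) (concatMap g xs) f) (cong (sumL (g x) f +_) (sumL-concatMap g xs f))

sumL-cong : {X : Set} (xs : List X) {f g : X → ℕ} → (∀ x → x ∈ xs → f x ≡ g x) → sumL xs f ≡ sumL xs g
sumL-cong []       h = refl
sumL-cong (x ∷ xs) h = cong₂ _+_ (h x (here refl)) (sumL-cong xs (λ y p → h y (there p)))

sumL-+ : {X : Set} (xs : List X) (f g : X → ℕ) → sumL xs (λ x → f x + g x) ≡ sumL xs f + sumL xs g
sumL-+ []       f g = refl
sumL-+ (x ∷ xs) f g = trans (cong (f x + g x +_) (sumL-+ xs f g)) (shuffle (f x) (g x) _ _)
  where
  shuffle : ∀ a b c d → a + b + (c + d) ≡ a + c + (b + d)
  shuffle = solve-∀

sumL-zero : {X : Set} (xs : List X) → sumL xs (λ _ → 0) ≡ 0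
sumL-zero []       = refl
sumL-zero (x ∷ xs) = sumL-zero xs

sumL-sumTo : {X : Set} (xs : List X) (N : ℕ) (f : X → ℕ → ℕ) →
             sumL xs (λ x → sumTo N (f x)) ≡ sumTo N (λ i → sumL xs (λ x → f x i))
sumL-sumTo []       N f = sym (sumTo-zero N (λ _ _ → refl))
sumL-sumTo (x ∷ xs) N f =
  trans (cong (sumTo N (f x) +_) (sumL-sumTo xs N f))
        (sym (sumTo-+ N (f x) (λ i → sumL xs (λ y → f y i))))

sumL-upTo : ∀ N (f : ℕ → ℕ) → sumL (upTo N) f ≡ sumTo N f
sumL-upTo zero    f = refl
sumL-upTo (suc N) f = begin
  sumL (upTo (suc N)) f       ≡⟨ cong (λ l → sumL l f) (sym (upTo-∷ʳ N)) ⟩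
  sumL (upTo N ++ [ N ]) f    ≡⟨ sumL-++ (upTo N) [ N ] f ⟩
  sumL (upTo N) f + (f N + 0) ≡⟨ cong₂ _+_ (sumL-upTo N f) (+-identityʳ (f N)) ⟩
  sumTo N f + f N             ∎
  where open ≡-Reasoning

sumL-sameMembers : {X : Set} {xs ys : List X} (f : X → ℕ) → Unique xs → Unique ys →
                   (∀ x → x ∈ xs → x ∈ ys) → (∀ x → x ∈ ys → x ∈ xs) → sumL xs f ≡ sumL ys f
sumL-sameMembers f u v to from =
  sum-↭ (Permₚ.map⁺ f (∼bag⇒↭ (unique∧set⇒bag u v (λ {x} → mk⇔ (to x) (from x)))))

∈-filterB⁻ : {X : Set} (p : X → Bool) {x : X} (xs : List X) → x ∈ filterB p xs → x ∈ xs × p x ≡ true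
∈-filterB⁻ p (y ∷ xs) m with p y in py
∈-filterB⁻ p (y ∷ xs) (here refl) | true = here refl , py
∈-filterB⁻ p (y ∷ xs) (there m)   | true = let (a , b) = ∈-filterB⁻ p xs m in there a , b
... | false = let (a , b) = ∈-filterB⁻ p xs m in there a , b

∈-filterB⁺ : {X : Set} (p : X → Bool) {x : X} (xs : List X) → x ∈ xs → p x ≡ true → x ∈ filterB p xs
∈-filterB⁺ p (y ∷ xs) m e with p y in py
∈-filterB⁺ p (y ∷ xs) (here refl) e | true  = here refl
∈-filterB⁺ p (y ∷ xs) (there m)   e | true  = there (∈-filterB⁺ p xs m e)
∈-filterB⁺ p (y ∷ xs) (here refl) e | false = case trans (sym e) py of λ ()
∈-filterB⁺ p (y ∷ xs) (there m)   e | false = ∈-filterB⁺ p xs m e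

unique-filterB : {X : Set} (p : X → Bool) (xs : List X) → Unique xs → Unique (filterB p xs)
unique-filterB p []       u       = []
unique-filterB p (y ∷ xs) (a ∷ u) with p y
... | true  = All.tabulate (λ m → All.lookup a (proj₁ (∈-filterB⁻ p xs m))) ∷ unique-filterB p xs u
... | false = unique-filterB p xs u

unique-map : {X Y : Set} (g : X → Y) (xs : List X) →
             (∀ a b → a ∈ xs → b ∈ xs → g a ≡ g b → a ≡ b) → Unique xs → Unique (map g xs)
unique-map g []       inj u       = []
unique-map g (x ∷ xs) inj (a ∷ u) =
  All.tabulate (λ {z} m → fresh z m) ∷ unique-map g xs (λ a b p q → inj a b (there p) (there q)) u
  where
  fresh : ∀ z → z ∈ map g xs → g x ≢ z
  fresh z m e with ∈-map⁻ g m
  ... | y , my , refl = All.lookup a my (inj x y (here refl) (there my) e)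

-- concatMap g xs is duplicate-free when each g x is and a retraction t
-- recovers x from every element of g x (so different blocks are disjoint).
unique-concatMap : {X Y : Set} (g : X → List Y) (t : Y → X) (xs : List X) → Unique xs →
                   (∀ x → x ∈ xs → Unique (g x)) → (∀ x y → x ∈ xs → y ∈ g x → t y ≡ x) →
                   Unique (concatMap g xs)
unique-concatMap g t []       u       ug tg = []
unique-concatMap g t (x ∷ xs) (a ∷ u) ug tg =
  Uniqueₚ.++⁺ (ug x (here refl))
              (unique-concatMap g t xs u (λ y m → ug y (there m)) (λ x y m → tg x y (there m)))
              disjoint
  where
  disjoint : ∀ {v} → v ∈ g x × v ∈ concatMap g xs → ⊥
  disjoint {v} (p , q) with find (∈-concatMap⁻ g {xs = xs} q)
  ... | x' , m , q' = All.lookup a m (trans (sym (tg x v (here refl) p)) (tg x' v (there m) q'))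

head₀ : {X : Set} → X → List X → X
head₀ d []      = d
head₀ d (x ∷ _) = x

head₀-∷ : {X : Set} (d x : X) (xss : List (List X)) (ys : List X) → ys ∈ map (x ∷_) xss → head₀ d ys ≡ x
head₀-∷ d x xss ys m with ∈-map⁻ (x ∷_) m
... | _ , _ , refl = refl

lists-∈⁻ : ∀ n xs ℓ → ℓ ∈ lists n xs → length ℓ ≡ n × All (_∈ xs) ℓ
lists-∈⁻ zero    xs .[] (here refl) = refl , []
lists-∈⁻ (suc n) xs ℓ m with find (∈-concatMap⁻ (λ x → map (x ∷_) (lists n xs)) {xs = xs} m)
... | x , mx , q with ∈-map⁻ (x ∷_) q
... | ℓ₀ , m₀ , refl = let (a , b) = lists-∈⁻ n xs ℓ₀ m₀ in cong suc a , mx ∷ b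

lists-∈⁺ : ∀ n xs ℓ → length ℓ ≡ n → All (_∈ xs) ℓ → ℓ ∈ lists n xs
lists-∈⁺ zero    xs []      refl []       = here refl
lists-∈⁺ (suc n) xs (x ∷ ℓ) e    (mx ∷ a) =
  ∈-concatMap⁺ (λ y → map (y ∷_) (lists n xs))
               (lose mx (∈-map⁺ (x ∷_) (lists-∈⁺ n xs ℓ (suc-injective e) a)))

unique-lists : ∀ n xs → Unique xs → Unique (lists n xs)
unique-lists zero    xs u = [] ∷ []
unique-lists (suc n) xs u =
  unique-concatMap (λ x → map (x ∷_) (lists n xs)) (head₀ 0) xs u
    (λ x _ → unique-map (x ∷_) (lists n xs) (λ _ _ _ _ → ∷-injectiveʳ) (unique-lists n xs u))
    (λ x ys _ m → head₀-∷ 0 x (lists n xs) ys m)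

bools : List Bool
bools = true ∷ false ∷ []

∈-bools : ∀ b → b ∈ bools
∈-bools true  = here refl
∈-bools false = there (here refl)

boolLists-∈⁻ : ∀ n mk → mk ∈ boolLists n → length mk ≡ n
boolLists-∈⁻ zero    .[] (here refl) = refl
boolLists-∈⁻ (suc n) mk  m with find (∈-concatMap⁻ (λ b → map (b ∷_) (boolLists n)) {xs = bools} m)
... | b , _ , q with ∈-map⁻ (b ∷_) q
... | mk₀ , m₀ , refl = cong suc (boolLists-∈⁻ n mk₀ m₀)

boolLists-∈⁺ : ∀ n mk → length mk ≡ n → mk ∈ boolLists n
boolLists-∈⁺ zero    []       refl = here refl
boolLists-∈⁺ (suc n) (b ∷ mk) e    =
  ∈-concatMap⁺ (λ y → map (y ∷_) (boolLists n))
               (lose (∈-bools b) (∈-map⁺ (b ∷_) (boolLists-∈⁺ n mk (suc-injective e))))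

unique-boolLists : ∀ n → Unique (boolLists n)
unique-boolLists zero    = [] ∷ []
unique-boolLists (suc n) =
  unique-concatMap (λ b → map (b ∷_) (boolLists n)) (head₀ false) bools
    (((λ ()) ∷ []) ∷ [] ∷ [])
    (λ b _ → unique-map (b ∷_) (boolLists n) (λ _ _ _ _ → ∷-injectiveʳ) (unique-boolLists n))
    (λ b ys _ m → head₀-∷ false b (boolLists n) ys m)

validB : ℕ → MSP → Bool
validB n (ℓ , mk) = isRGF ℓ ∧ canonMarks n ℓ mk

Valid : ℕ → MSP → Set
Valid n (ℓ , mk) = length ℓ ≡ n × All (_< n) ℓ × length mk ≡ n × validB n (ℓ , mk) ≡ true

candidates : ℕ → List MSP
candidates n = concatMap (λ ℓ → map (ℓ ,_) (boolLists n)) (lists n (upTo n))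

allMSP-∈⁻ : ∀ n p → p ∈ allMSP n → Valid n p
allMSP-∈⁻ n p m with ∈-filterB⁻ (validB n) (candidates n) m
... | m' , v with find (∈-concatMap⁻ (λ ℓ → map (ℓ ,_) (boolLists n)) {xs = lists n (upTo n)} m')
... | ℓ , mℓ , q with ∈-map⁻ (ℓ ,_) q
... | mk , mmk , refl =
  let (a , b) = lists-∈⁻ n (upTo n) ℓ mℓ in a , All.map ∈-upTo⁻ b , boolLists-∈⁻ n mk mmk , v

allMSP-∈⁺ : ∀ n p → Valid n p → p ∈ allMSP n
allMSP-∈⁺ n (ℓ , mk) (a , b , c , v) =
  ∈-filterB⁺ (validB n) (candidates n)
    (∈-concatMap⁺ (λ ℓ → map (ℓ ,_) (boolLists n))
      (lose (lists-∈⁺ n (upTo n) ℓ a (All.map ∈-upTo⁺ b)) (∈-map⁺ (ℓ ,_) (boolLists-∈⁺ n mk c))))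
    v

unique-allMSP : ∀ n → Unique (allMSP n)
unique-allMSP n =
  unique-filterB (validB n) (candidates n)
    (unique-concatMap (λ ℓ → map (ℓ ,_) (boolLists n)) proj₁ (lists n (upTo n))
      (unique-lists n (upTo n) (Uniqueₚ.upTo⁺ n))
      (λ ℓ _ → unique-map (ℓ ,_) (boolLists n) (λ { _ _ _ _ refl → refl }) (unique-boolLists n))
      (λ ℓ y _ m → case ∈-map⁻ (ℓ ,_) m of λ { (_ , _ , refl) → refl }))

atB-applyUpTo : ∀ n f j → j < n → atB (applyUpTo f n) j ≡ f j
atB-applyUpTo (suc n) f zero    p = refl
atB-applyUpTo (suc n) f (suc j) p = atB-applyUpTo n (f ∘ suc) j (≤-pred p)

atB-applyUpTo-≥ : ∀ n f j → n ≤ j → atB (applyUpTo f n) j ≡ false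
atB-applyUpTo-≥ zero    f j       p = refl
atB-applyUpTo-≥ (suc n) f (suc j) p = atB-applyUpTo-≥ n (f ∘ suc) j (≤-pred p)

atB-beyond : ∀ (mk : List Bool) j → length mk ≤ j → atB mk j ≡ false
atB-beyond []       j       p = refl
atB-beyond (x ∷ mk) (suc j) p = atB-beyond mk j (≤-pred p)

atB-ext : ∀ (a b : List Bool) → length a ≡ length b → (∀ j → j < length a → atB a j ≡ atB b j) → a ≡ b
atB-ext []      []      e h = refl
atB-ext (x ∷ a) (y ∷ b) e h =
  cong₂ _∷_ (h 0 (s≤s z≤n)) (atB-ext a b (suc-injective e) (λ j p → h (suc j) (s≤s p)))

at-snoc : ∀ (ℓ : List ℕ) x i → i < length ℓ → at (ℓ ++ [ x ]) i ≡ at ℓ i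
at-snoc (y ∷ ℓ) x zero    p = refl
at-snoc (y ∷ ℓ) x (suc i) p = at-snoc ℓ x i (≤-pred p)

at-snoc-last : ∀ (ℓ : List ℕ) x → at (ℓ ++ [ x ]) (length ℓ) ≡ x
at-snoc-last []      x = refl
at-snoc-last (y ∷ ℓ) x = at-snoc-last ℓ x

length-snoc : ∀ (ℓ : List ℕ) x → length (ℓ ++ [ x ]) ≡ suc (length ℓ)
length-snoc []      x = refl
length-snoc (y ∷ ℓ) x = cong suc (length-snoc ℓ x)

snoc-view : ∀ n (ℓ : List ℕ) → length ℓ ≡ suc n → ∃[ ℓ₀ ] ∃[ x ] (ℓ ≡ ℓ₀ ++ [ x ] × length ℓ₀ ≡ n)
snoc-view zero    (x ∷ []) e = [] , x , refl , refl
snoc-view (suc n) (y ∷ ℓ)  e with snoc-view n ℓ (suc-injective e)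
... | ℓ₀ , x , refl , e' = y ∷ ℓ₀ , x , refl , cong suc e'

at-all : ∀ {P : ℕ → Set} (ℓ : List ℕ) → (∀ i → i < length ℓ → P (at ℓ i)) → All P ℓ
at-all []      h = []
at-all (x ∷ ℓ) h = h 0 (s≤s z≤n) ∷ at-all ℓ (λ i p → h (suc i) (s≤s p))

initL : List ℕ → List ℕ
initL []          = []
initL (x ∷ [])    = []
initL (x ∷ y ∷ t) = x ∷ initL (y ∷ t)

lastL : List ℕ → ℕ
lastL []          = 0
lastL (x ∷ [])    = x
lastL (x ∷ y ∷ t) = lastL (y ∷ t)

initL-snoc : ∀ (ℓ : List ℕ) x → initL (ℓ ++ [ x ]) ≡ ℓ
initL-snoc []          x = refl
initL-snoc (y ∷ [])    x = refl
initL-snoc (y ∷ z ∷ ℓ) x = cong (y ∷_) (initL-snoc (z ∷ ℓ) x)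

lastL-snoc : ∀ (ℓ : List ℕ) x → lastL (ℓ ++ [ x ]) ≡ x
lastL-snoc []          x = refl
lastL-snoc (y ∷ [])    x = refl
lastL-snoc (y ∷ z ∷ ℓ) x = lastL-snoc (z ∷ ℓ) x

nextBlocks : ℕ → ℕ → ℕ
nextBlocks k x = if x ≡ᵇ k then suc k else k

nextBlocks-new : ∀ k → nextBlocks k k ≡ suc k
nextBlocks-new k = cong (λ u → if u then suc k else k) (≡ᵇ-refl k)

nextBlocks-old : ∀ k x → x ≢ k → nextBlocks k x ≡ k
nextBlocks-old k x p = cong (λ u → if u then suc k else k) (≡ᵇ-false p)

nextBlocks-≥ : ∀ k x → k ≤ nextBlocks k x
nextBlocks-≥ k x with x ≡ᵇ k
... | true  = n≤1+n k
... | false = ≤-refl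

blocksFrom-snoc : ∀ k (ℓ : List ℕ) x → blocksFrom k (ℓ ++ [ x ]) ≡ nextBlocks (blocksFrom k ℓ) x
blocksFrom-snoc k []      x = refl
blocksFrom-snoc k (y ∷ ℓ) x = blocksFrom-snoc (nextBlocks k y) ℓ x

rgfFrom-snoc : ∀ k (ℓ : List ℕ) x → rgfFrom k (ℓ ++ [ x ]) ≡ (rgfFrom k ℓ ∧ (x <ᵇ suc (blocksFrom k ℓ)))
rgfFrom-snoc k []      x = Boolₚ.∧-identityʳ (x <ᵇ suc k)
rgfFrom-snoc k (y ∷ ℓ) x with y <ᵇ suc k
... | true  = rgfFrom-snoc (nextBlocks k y) ℓ x
... | false = refl

numBlocks-snoc : ∀ (ℓ : List ℕ) x → numBlocks (ℓ ++ [ x ]) ≡ nextBlocks (numBlocks ℓ) x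
numBlocks-snoc = blocksFrom-snoc 0

isRGF-snoc : ∀ (ℓ : List ℕ) x → isRGF (ℓ ++ [ x ]) ≡ (isRGF ℓ ∧ (x <ᵇ suc (numBlocks ℓ)))
isRGF-snoc = rgfFrom-snoc 0

module Snoc (n : ℕ) (ℓ : List ℕ) (x : ℕ) (len : length ℓ ≡ n) where

  old-entry : ∀ i → i < n → at (ℓ ++ [ x ]) i ≡ at ℓ i
  old-entry i p = at-snoc ℓ x i (subst (i <_) (sym len) p)

  last-entry : at (ℓ ++ [ x ]) n ≡ x
  last-entry = subst (λ k → at (ℓ ++ [ x ]) k ≡ x) len (at-snoc-last ℓ x)

  position : ∀ i → i < suc n → (i < n × at (ℓ ++ [ x ]) i ≡ at ℓ i) ⊎ (at (ℓ ++ [ x ]) i ≡ x)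
  position i p with i ≟ n
  ... | yes refl = inj₂ last-entry
  ... | no q     = inj₁ (≤∧≢⇒< (≤-pred p) q , old-entry i (≤∧≢⇒< (≤-pred p) q))

record RGFfacts (n : ℕ) (ℓ : List ℕ) : Set where
  field
    numBlocks≤ : numBlocks ℓ ≤ n
    label<     : ∀ i → i < n → at ℓ i < numBlocks ℓ
    occupied   : ∀ j → j < numBlocks ℓ → ∃[ i ] (i < n × at ℓ i ≡ j)

rgfFacts-snoc : ∀ n (ℓ : List ℕ) x → length ℓ ≡ n → x ≤ numBlocks ℓ →
                RGFfacts n ℓ → RGFfacts (suc n) (ℓ ++ [ x ])
rgfFacts-snoc n ℓ x len x≤ F with x ≟ numBlocks ℓ
... | yes refl = record
  { numBlocks≤ = subst (_≤ suc n) (sym nb-new) (s≤s numBlocks≤)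
  ; label<     = λ i p → subst (at ℓ' i <_) (sym nb-new) (case position i p of λ
      { (inj₁ (q , a)) → subst (_< suc x) (sym a) (m<n⇒m<1+n (label< i q))
      ; (inj₂ a)       → subst (_< suc x) (sym a) (n<1+n x) })
  ; occupied   = λ j p → case j ≟ x of λ
      { (yes refl) → n , n<1+n n , last-entry
      ; (no q)     → let (i , a , b) = occupied j (≤∧≢⇒< (≤-pred (subst (j <_) nb-new p)) q)
                     in i , m<n⇒m<1+n a , trans (old-entry i a) b } }
  where
  open RGFfacts F
  open Snoc n ℓ x len
  ℓ' = ℓ ++ [ x ]
  nb-new : numBlocks ℓ' ≡ suc (numBlocks ℓ)
  nb-new = trans (numBlocks-snoc ℓ x) (nextBlocks-new (numBlocks ℓ))
... | no x≢ = record
  { numBlocks≤ = subst (_≤ suc n) (sym nb-old) (m≤n⇒m≤1+n numBlocks≤)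
  ; label<     = λ i p → subst (at ℓ' i <_) (sym nb-old) (case position i p of λ
      { (inj₁ (q , a)) → subst (_< numBlocks ℓ) (sym a) (label< i q)
      ; (inj₂ a)       → subst (_< numBlocks ℓ) (sym a) (≤∧≢⇒< x≤ x≢) })
  ; occupied   = λ j p → let (i , a , b) = occupied j (subst (j <_) nb-old p)
                         in i , m<n⇒m<1+n a , trans (old-entry i a) b }
  where
  open RGFfacts F
  open Snoc n ℓ x len
  ℓ' = ℓ ++ [ x ]
  nb-old : numBlocks ℓ' ≡ numBlocks ℓ
  nb-old = trans (numBlocks-snoc ℓ x) (nextBlocks-old (numBlocks ℓ) x x≢)

rgfFacts : ∀ n (ℓ : List ℕ) → length ℓ ≡ n → isRGF ℓ ≡ true → RGFfacts n ℓ
rgfFacts zero    []  refl r = record { numBlocks≤ = z≤n ; label< = λ _ () ; occupied = λ _ () }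
rgfFacts (suc n) ℓ e r with snoc-view n ℓ e
... | ℓ₀ , x , refl , len = rgfFacts-snoc n ℓ₀ x len x≤ (rgfFacts n ℓ₀ len (∧-elimˡ r'))
  where
  r' : (isRGF ℓ₀ ∧ (x <ᵇ suc (numBlocks ℓ₀))) ≡ true
  r' = trans (sym (isRGF-snoc ℓ₀ x)) r
  x≤ : x ≤ numBlocks ℓ₀
  x≤ = ≤-pred (<ᵇ-elim (∧-elimʳ {isRGF ℓ₀} r'))

-- Open blocks are conveniently indexed by their
-- maxima instead of their labels, which is what the weight statistic
-- refers to.

private
  nand-intro : ∀ {a b} → (a ≡ false) ⊎ (b ≡ false) → (not a ∨ not b) ≡ true
  nand-intro         (inj₁ refl) = refl
  nand-intro {true}  (inj₂ refl) = refl
  nand-intro {false} (inj₂ refl) = refl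

  nand-elim : ∀ {a b} → (not a ∨ not b) ≡ true → a ≡ true → b ≡ true → ⊥
  nand-elim {true} {true} () refl refl

module _ (n : ℕ) (ℓ : List ℕ) where

  isMaxOf-elim : ∀ j i → isMaxOf n ℓ j i ≡ true →
                 i < n × at ℓ i ≡ j × (∀ i' → i' < n → i < i' → at ℓ i' ≢ j)
  isMaxOf-elim j i e =
    <ᵇ-elim (∧-elimˡ e) , ≡ᵇ-elim (∧-elimˡ e₂) ,
    (λ i' p q r → nand-elim (allTo-elim n (∧-elimʳ {at ℓ i ≡ᵇ j} e₂) i' p) (<ᵇ-intro q) (≡ᵇ-intro r))
    where e₂ = ∧-elimʳ {i <ᵇ n} e

  isMaxOf-intro : ∀ j i → i < n → at ℓ i ≡ j → (∀ i' → i' < n → i < i' → at ℓ i' ≢ j) →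
                  isMaxOf n ℓ j i ≡ true
  isMaxOf-intro j i p q h = ∧-intro (<ᵇ-intro p) (∧-intro (≡ᵇ-intro q) (allTo-intro n λ i' r → nand-intro (later i' r)))
    where
    later : ∀ i' → i' < n → ((i <ᵇ i') ≡ false) ⊎ ((at ℓ i' ≡ᵇ j) ≡ false)
    later i' r with i <? i'
    ... | yes s = inj₂ (≡ᵇ-false (h i' r s))
    ... | no s  = inj₁ (<ᵇ-false (≮⇒≥ s))

  isMaxOf-label : ∀ j i → isMaxOf n ℓ j i ≡ true → j ≡ at ℓ i
  isMaxOf-label j i e = sym (proj₁ (proj₂ (isMaxOf-elim j i e)))

  isMaxOf-unique : ∀ j i i' → isMaxOf n ℓ j i ≡ true → isMaxOf n ℓ j i' ≡ true → i ≡ i'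
  isMaxOf-unique j i i' e e' with isMaxOf-elim j i e | isMaxOf-elim j i' e' | <-cmp i i'
  ... | _ , _ , later | p' , q' , _ | tri< i<i' _ _ = ⊥-elim (later i' p' i<i' q')
  ... | _ | _ | tri≈ _ i≡i' _ = i≡i'
  ... | p , q , _ | _ , _ , later' | tri> _ _ i'<i = ⊥-elim (later' i p i'<i q)

  isMaxOf-exists : ∀ j i → i < n → at ℓ i ≡ j → ∃[ m ] (isMaxOf n ℓ j m ≡ true)
  isMaxOf-exists j i p q = search n ≤-refl i p q (λ i' a b → ⊥-elim (<⇒≱ b a))
    where
    -- scan downwards from N-1, knowing that no position ≥ N lies in block j
    search : ∀ N → N ≤ n → ∀ i → i < N → at ℓ i ≡ j → (∀ i' → N ≤ i' → i' < n → at ℓ i' ≢ j) →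
             ∃[ m ] (isMaxOf n ℓ j m ≡ true)
    search (suc N) N<n i i<N e none with at ℓ N ≟ j
    ... | yes eN = N , isMaxOf-intro j N N<n eN (λ i' r s → none i' s r)
    ... | no nN  = search N (≤-trans (n≤1+n N) N<n) i (≤∧≢⇒< (≤-pred i<N) (λ { refl → nN e })) e
                     (λ i' a b → case i' ≟ N of λ
                        { (yes refl) → nN
                        ; (no z)     → none i' (≤∧≢⇒< a (z ∘ sym)) b })

  isBlockMax : (ℕ → Bool) → ℕ → Bool
  isBlockMax op i = op (at ℓ i) ∧ isMaxOf n ℓ (at ℓ i) i

  count-by-maxima : (op : ℕ → Bool) → (∀ i → i < n → at ℓ i < n) → (P : ℕ → Bool) →
                    countTo n (λ j → op j ∧ anyTo n (λ i → isMaxOf n ℓ j i ∧ P i))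
                    ≡ countTo n (λ i → isBlockMax op i ∧ P i)
  count-by-maxima op label<n P = begin
      countTo n (λ j → op j ∧ anyTo n (λ i → isMaxOf n ℓ j i ∧ P i))
    ≡⟨ countTo-sum n _ ⟩
      sumTo n (λ j → ⟦ op j ∧ anyTo n (λ i → isMaxOf n ℓ j i ∧ P i) ⟧)
    ≡⟨ sumTo-cong n (λ j _ → trans (⟦∧⟧ (op j) _) (cong (⟦ op j ⟧ *_) (at-most-one j))) ⟩
      sumTo n (λ j → ⟦ op j ⟧ * sumTo n (λ i → ⟦ isMaxOf n ℓ j i ∧ P i ⟧))
    ≡⟨ sumTo-cong n (λ j _ → sym (sumTo-*ˡ n ⟦ op j ⟧ _)) ⟩
      sumTo n (λ j → sumTo n (λ i → ⟦ op j ⟧ * ⟦ isMaxOf n ℓ j i ∧ P i ⟧))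
    ≡⟨ sumTo-swap n n _ ⟩
      sumTo n (λ i → sumTo n (λ j → ⟦ op j ⟧ * ⟦ isMaxOf n ℓ j i ∧ P i ⟧))
    ≡⟨ sumTo-cong n (λ i p → trans (sumTo-single n (at ℓ i) (label<n i p) (λ j _ → other-label i j))
                                   (sym (own-label i))) ⟩
      sumTo n (λ i → ⟦ isBlockMax op i ∧ P i ⟧)
    ≡⟨ sym (countTo-sum n _) ⟩
      countTo n (λ i → isBlockMax op i ∧ P i)
    ∎
    where
    open ≡-Reasoning
    at-most-one : ∀ j → ⟦ anyTo n (λ i → isMaxOf n ℓ j i ∧ P i) ⟧ ≡ sumTo n (λ i → ⟦ isMaxOf n ℓ j i ∧ P i ⟧)
    at-most-one j = trans (anyTo-count n (λ i i' _ _ a b → isMaxOf-unique j i i' (∧-elimˡ a) (∧-elimˡ b)))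
                          (countTo-sum n _)
    other-label : ∀ i j → j ≢ at ℓ i → ⟦ op j ⟧ * ⟦ isMaxOf n ℓ j i ∧ P i ⟧ ≡ 0
    other-label i j ne with isMaxOf n ℓ j i in e
    ... | true  = ⊥-elim (ne (isMaxOf-label j i e))
    ... | false = *-zeroʳ ⟦ op j ⟧
    own-label : ∀ i → ⟦ isBlockMax op i ∧ P i ⟧ ≡ ⟦ op (at ℓ i) ⟧ * ⟦ isMaxOf n ℓ (at ℓ i) i ∧ P i ⟧
    own-label i = trans (cong ⟦_⟧ (Boolₚ.∧-assoc (op (at ℓ i)) (isMaxOf n ℓ (at ℓ i) i) (P i)))
                        (⟦∧⟧ (op (at ℓ i)) _)

-- A marked partition of [n+1] is obtained from one of [n] by putting the
-- new last position n into the block with label x (a new singleton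
-- block when x = numBlocks ℓ) and giving that block the mark b; all
-- other marks are kept.

extendMarks : ℕ → List Bool → ℕ → Bool → List Bool
extendMarks n mk x b = applyUpTo (λ j → if j ≡ᵇ x then b else atB mk j) (suc n)

extend : ℕ → MSP → ℕ × Bool → MSP
extend n (ℓ , mk) (x , b) = ℓ ++ [ x ] , extendMarks n mk x b

module Extension (n : ℕ) (ℓ : List ℕ) (mk : List Bool) (x : ℕ) (b : Bool)
                 (len : length ℓ ≡ n) (F : RGFfacts n ℓ) (x≤ : x ≤ numBlocks ℓ) where
  open RGFfacts F
  open Snoc n ℓ x len

  ℓ' : List ℕ
  ℓ' = ℓ ++ [ x ]

  mk' : List Bool
  mk' = extendMarks n mk x b

  nb : ℕ
  nb = numBlocks ℓ

  x<1+n : x < suc n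
  x<1+n = s≤s (≤-trans x≤ numBlocks≤)

  x-isBlock : x < numBlocks ℓ'
  x-isBlock with x ≟ nb
  ... | yes refl = subst (x <_) (sym (trans (numBlocks-snoc ℓ x) (nextBlocks-new nb))) (n<1+n x)
  ... | no q     = subst (x <_) (sym (trans (numBlocks-snoc ℓ x) (nextBlocks-old nb x q))) (≤∧≢⇒< x≤ q)

  other-isBlock : ∀ j → j ≢ x → (j <ᵇ numBlocks ℓ') ≡ (j <ᵇ nb)
  other-isBlock j j≢x with x ≟ nb
  ... | no q = cong (j <ᵇ_) (trans (numBlocks-snoc ℓ x) (nextBlocks-old nb x q))
  ... | yes refl with j <? nb
  ...   | yes p = trans (cong (j <ᵇ_) (trans (numBlocks-snoc ℓ x) (nextBlocks-new nb)))
                        (trans (<ᵇ-intro (m<n⇒m<1+n p)) (sym (<ᵇ-intro p)))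
  ...   | no p  = trans (cong (j <ᵇ_) (trans (numBlocks-snoc ℓ x) (nextBlocks-new nb)))
                        (trans (<ᵇ-false (≤∧≢⇒< (≮⇒≥ p) (j≢x ∘ sym))) (sym (<ᵇ-false (≮⇒≥ p))))

  -- Label n never names a block of ℓ (there are at most n blocks).
  isOpen-n : isOpen n (ℓ , mk) n ≡ false
  isOpen-n = ∧-falseˡ (atB mk n) (<ᵇ-false numBlocks≤)

  isOpen-extend : ∀ j → j < suc n → isOpen (suc n) (ℓ' , mk') j ≡ (if j ≡ᵇ x then b else isOpen n (ℓ , mk) j)
  isOpen-extend j p with j ≟ x
  ... | yes refl rewrite ≡ᵇ-refl j | <ᵇ-intro x-isBlock | atB-applyUpTo (suc n) (λ j → if j ≡ᵇ x then b else atB mk j) j p | ≡ᵇ-refl j = refl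
  ... | no q rewrite ≡ᵇ-false q | other-isBlock j q | atB-applyUpTo (suc n) (λ j → if j ≡ᵇ x then b else atB mk j) j p | ≡ᵇ-false q = refl

  openBlocks-extend : openBlocks (suc n) (ℓ' , mk') + ⟦ isOpen n (ℓ , mk) x ⟧ ≡ openBlocks n (ℓ , mk) + ⟦ b ⟧
  openBlocks-extend =
    trans (cong (_+ ⟦ isOpen n (ℓ , mk) x ⟧) (countTo-cong (suc n) isOpen-extend))
    (trans (countTo-update (suc n) x b (isOpen n (ℓ , mk)) x<1+n)
           (cong (_+ ⟦ b ⟧) (trans (cong (countTo n (isOpen n (ℓ , mk)) +_) (cong ⟦_⟧ isOpen-n)) (+-identityʳ _))))

  isArc-old : ∀ a c → c < n → isArc (suc n) ℓ' a c ≡ isArc n ℓ a c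
  isArc-old a c c<n with a <? c
  ... | no q rewrite <ᵇ-false {a} {c} (≮⇒≥ q) = refl
  ... | yes q rewrite <ᵇ-intro q | <ᵇ-intro (m<n⇒m<1+n c<n) | <ᵇ-intro c<n
                    | old-entry a (<-trans q c<n) | old-entry c c<n =
    cong ((at ℓ a ≡ᵇ at ℓ c) ∧_)
         (allTo-cong c (λ i p → cong (λ u → not (a <ᵇ i) ∨ not (u ≡ᵇ at ℓ a)) (old-entry i (<-trans p c<n))))

  isArc-new : ∀ a → isArc (suc n) ℓ' a n ≡ isMaxOf n ℓ x a
  isArc-new a with a <? n
  ... | no q rewrite <ᵇ-false {a} {n} (≮⇒≥ q) = refl
  ... | yes q rewrite <ᵇ-intro q | <ᵇ-intro (n<1+n n) | old-entry a q | last-entry with at ℓ a ≟ x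
  ...   | yes refl = cong ((at ℓ a ≡ᵇ at ℓ a) ∧_)
                          (allTo-cong n (λ i p → cong (λ u → not (a <ᵇ i) ∨ not (u ≡ᵇ at ℓ a)) (old-entry i p)))
  ...   | no r rewrite ≡ᵇ-false r = refl

  isArc-from-n : ∀ c → c < suc n → isArc (suc n) ℓ' n c ≡ false
  isArc-from-n c p rewrite <ᵇ-false {n} {c} (≤-pred p) = refl

  isMaxOf-old : ∀ j i → i < n → isMaxOf (suc n) ℓ' j i ≡ (isMaxOf n ℓ j i ∧ not (x ≡ᵇ j))
  isMaxOf-old j i i<n = bool-ext to from
    where
    to : isMaxOf (suc n) ℓ' j i ≡ true → (isMaxOf n ℓ j i ∧ not (x ≡ᵇ j)) ≡ true
    to e with isMaxOf-elim (suc n) ℓ' j i e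
    ... | _ , q , h =
      ∧-intro (isMaxOf-intro n ℓ j i i<n (trans (sym (old-entry i i<n)) q)
                             (λ i' r s t → h i' (m<n⇒m<1+n r) s (trans (old-entry i' r) t)))
              (cong not (≡ᵇ-false (λ xj → h n (n<1+n n) i<n (trans last-entry xj))))
    from : (isMaxOf n ℓ j i ∧ not (x ≡ᵇ j)) ≡ true → isMaxOf (suc n) ℓ' j i ≡ true
    from e with isMaxOf-elim n ℓ j i (∧-elimˡ e)
    ... | _ , q , h = isMaxOf-intro (suc n) ℓ' j i (m<n⇒m<1+n i<n) (trans (old-entry i i<n) q) later
      where
      later : ∀ i' → i' < suc n → i < i' → at ℓ' i' ≢ j
      later i' r s t with i' ≟ n
      ... | yes refl = case trans (sym (cong not (≡ᵇ-intro (trans (sym last-entry) t))))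
                                  (∧-elimʳ {isMaxOf n ℓ j i} e) of λ ()
      ... | no ne = h i' (≤∧≢⇒< (≤-pred r) ne) s (trans (sym (old-entry i' (≤∧≢⇒< (≤-pred r) ne))) t)

  -- Crossings gained through the new arc (c , n), c the maximum of block
  -- x: one for every old arc (a , c') with a < c < c' < n.
  newCrossings : ℕ
  newCrossings = sumTo n λ a → sumTo n λ c' → sumTo n λ c →
    ⟦ isArc n ℓ a c' ∧ isMaxOf n ℓ x c ∧ (a <ᵇ c) ∧ (c <ᵇ c') ∧ (c' <ᵇ n) ⟧

  crossings-extend : crossings (suc n) ℓ' ≡ crossings n ℓ + newCrossings
  crossings-extend = begin
      crossings (suc n) ℓ'
    ≡⟨ sumTo-dropLast n _ (sumTo-zero (suc n) λ c' p → sumTo-zero (suc n) λ c _ →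
                            countTo-zero (suc n) λ e _ → ∧-falseˡ _ (isArc-from-n c' p)) ⟩
      sumTo n (λ a → sumTo (suc n) λ c' → sumTo (suc n) λ c → countTo (suc n) (C a c' c))
    ≡⟨ sumTo-cong n (λ a _ → sumTo-dropLast n _ (sumTo-zero (suc n) λ c _ →
                               countTo-zero (suc n) λ e r → arc-to-n-crosses-nothing a c e r)) ⟩
      sumTo n (λ a → sumTo n λ c' → sumTo (suc n) λ c → countTo (suc n) (C a c' c))
    ≡⟨ sumTo-cong n (λ a _ → sumTo-cong n λ c' pc' → sumTo-dropLast n _ (countTo-zero (suc n) λ e _ →
                               arc-from-n-crosses-nothing a c' e pc')) ⟩
      sumTo n (λ a → sumTo n λ c' → sumTo n λ c → countTo (suc n) (C a c' c))
    ≡⟨ sumTo-cong n (λ a _ → sumTo-cong n λ c' pc' → sumTo-cong n λ c _ → split a c' c pc') ⟩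
      sumTo n (λ a → sumTo n λ c' → sumTo n λ c → countTo n (old a c' c) + new a c' c)
    ≡⟨ sumTo-cong n (λ a _ → trans (sumTo-cong n λ c' _ → sumTo-+ n _ _) (sumTo-+ n _ _)) ⟩
      sumTo n (λ a → crossings-from a + newCrossings-from a)
    ≡⟨ sumTo-+ n _ _ ⟩
      crossings n ℓ + newCrossings
    ∎
    where
    open ≡-Reasoning
    C : ℕ → ℕ → ℕ → ℕ → Bool
    C a c' c e = isArc (suc n) ℓ' a c' ∧ isArc (suc n) ℓ' c e ∧ (a <ᵇ c) ∧ (c <ᵇ c') ∧ (c' <ᵇ e)
    old : ℕ → ℕ → ℕ → ℕ → Bool
    old a c' c e = isArc n ℓ a c' ∧ isArc n ℓ c e ∧ (a <ᵇ c) ∧ (c <ᵇ c') ∧ (c' <ᵇ e)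
    new : ℕ → ℕ → ℕ → ℕ
    new a c' c = ⟦ isArc n ℓ a c' ∧ isMaxOf n ℓ x c ∧ (a <ᵇ c) ∧ (c <ᵇ c') ∧ (c' <ᵇ n) ⟧
    crossings-from newCrossings-from : ℕ → ℕ
    crossings-from a = sumTo n λ c' → sumTo n λ c → countTo n (old a c' c)
    newCrossings-from a = sumTo n λ c' → sumTo n λ c → new a c' c
    -- an arc (a , n) would need a crossing arc ending beyond n
    arc-to-n-crosses-nothing : ∀ a c e → e < suc n → C a n c e ≡ false
    arc-to-n-crosses-nothing a c e r rewrite <ᵇ-false {n} {e} (≤-pred r) =
      ∧-falseʳ (isArc (suc n) ℓ' a n) (∧-falseʳ (isArc (suc n) ℓ' c e) (∧-falseʳ (a <ᵇ c) (∧-falseʳ (c <ᵇ n) refl)))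
    -- an arc starting at n would need n < c' < n
    arc-from-n-crosses-nothing : ∀ a c' e → c' < n → C a c' n e ≡ false
    arc-from-n-crosses-nothing a c' e r rewrite <ᵇ-false {n} {c'} (<⇒≤ r) =
      ∧-falseʳ (isArc (suc n) ℓ' a c') (∧-falseʳ (isArc (suc n) ℓ' n e) (∧-falseʳ (a <ᵇ n) refl))
    -- the last term (e = n) is the new arc (c , n)
    split : ∀ a c' c → c' < n → countTo (suc n) (C a c' c) ≡ countTo n (old a c' c) + new a c' c
    split a c' c pc' =
      cong₂ _+_ (countTo-cong n (λ e pe → cong₂ _∧_ (isArc-old a c' pc') (cong (_∧ _) (isArc-old c e pe))))
                (cong ⟦_⟧ (cong₂ _∧_ (isArc-old a c' pc') (cong (_∧ _) (isArc-new c))))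

  -- Arc/open-block pairs.  Appending n to block x destroys the pairs
  -- (arc , block x) (block x now ends at n) and creates the pairs
  -- (new arc (a , n) , open block ≠ x ending after a).

  λ₀ λ₁ : MSP
  λ₀ = ℓ , mk
  λ₁ = ℓ' , mk'

  pair : ℕ → ℕ → ℕ → Bool
  pair a c j = isArc n ℓ a c ∧ isOpen n λ₀ j ∧ anyTo n (λ i → isMaxOf n ℓ j i ∧ (a <ᵇ i) ∧ (i <ᵇ c))

  pair' : ℕ → ℕ → ℕ → Bool
  pair' a c j = isArc (suc n) ℓ' a c ∧ isOpen (suc n) λ₁ j
                ∧ anyTo (suc n) (λ i → isMaxOf (suc n) ℓ' j i ∧ (a <ᵇ i) ∧ (i <ᵇ c))

  lostPairs : ℕ
  lostPairs = sumTo n λ a → sumTo n λ c → ⟦ pair a c x ⟧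

  openAfter : ℕ → ℕ → Bool
  openAfter a j = isOpen n λ₀ j ∧ anyTo n (λ i → isMaxOf n ℓ j i ∧ (a <ᵇ i))

  openBlocksAfter : ℕ → ℕ
  openBlocksAfter a = countTo n (openAfter a)

  newPairs : ℕ
  newPairs = sumTo n λ a → ⟦ isMaxOf n ℓ x a ⟧ * openBlocksAfter a

  maxAt-extend : ∀ j (R : ℕ → Bool) → R n ≡ false →
                 anyTo (suc n) (λ i → isMaxOf (suc n) ℓ' j i ∧ R i)
                 ≡ (if j ≡ᵇ x then false else anyTo n (λ i → isMaxOf n ℓ j i ∧ R i))
  maxAt-extend j R Rn rewrite Rn | Boolₚ.∧-zeroʳ (isMaxOf (suc n) ℓ' j n)
                            | Boolₚ.∨-identityʳ (anyTo n (λ i → isMaxOf (suc n) ℓ' j i ∧ R i)) with j ≟ x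
  ... | yes refl rewrite ≡ᵇ-refl j =
    anyTo-false n (λ i p → ∧-falseˡ (R i) (trans (isMaxOf-old j i p)
                                             (∧-falseʳ (isMaxOf n ℓ j i) (cong not (≡ᵇ-refl j)))))
  ... | no q rewrite ≡ᵇ-false q =
    anyTo-cong n (λ i p → cong (_∧ R i) (trans (isMaxOf-old j i p)
                   (trans (cong (λ u → isMaxOf n ℓ j i ∧ not u) (≡ᵇ-false (q ∘ sym))) (Boolₚ.∧-identityʳ _))))

  pair-oldArc : ∀ a c → c < n → ∀ j → j < suc n → pair' a c j ≡ (if j ≡ᵇ x then false else pair a c j)
  pair-oldArc a c pc j pj
    rewrite isArc-old a c pc | isOpen-extend j pj
          | maxAt-extend j (λ i → (a <ᵇ i) ∧ (i <ᵇ c)) (∧-falseʳ (a <ᵇ n) (<ᵇ-false (<⇒≤ pc)))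
    with j ≡ᵇ x
  ... | true  = ∧-falseʳ (isArc n ℓ a c) (Boolₚ.∧-zeroʳ b)
  ... | false = refl

  count-oldArc : ∀ a c → c < n → countTo (suc n) (pair' a c) + ⟦ pair a c x ⟧ ≡ countTo n (pair a c)
  count-oldArc a c pc = begin
      countTo (suc n) (pair' a c) + ⟦ pair a c x ⟧
    ≡⟨ cong (_+ ⟦ pair a c x ⟧) (countTo-cong (suc n) (pair-oldArc a c pc)) ⟩
      countTo (suc n) (λ j → if j ≡ᵇ x then false else pair a c j) + ⟦ pair a c x ⟧
    ≡⟨ countTo-update (suc n) x false (pair a c) x<1+n ⟩
      countTo n (pair a c) + ⟦ pair a c n ⟧ + 0
    ≡⟨ cong (λ u → countTo n (pair a c) + ⟦ u ⟧ + 0) (∧-falseʳ (isArc n ℓ a c) (∧-falseˡ _ isOpen-n)) ⟩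
      countTo n (pair a c) + 0 + 0
    ≡⟨ trans (+-identityʳ _) (+-identityʳ _) ⟩
      countTo n (pair a c)
    ∎
    where open ≡-Reasoning

  pair-newArc : ∀ a j → j < suc n →
                pair' a n j ≡ (isMaxOf n ℓ x a ∧ (if j ≡ᵇ x then false else openAfter a j))
  pair-newArc a j pj
    rewrite isArc-new a | isOpen-extend j pj
          | maxAt-extend j (λ i → (a <ᵇ i) ∧ (i <ᵇ n)) (∧-falseʳ (a <ᵇ n) (<ᵇ-false (≤-refl {n})))
    with j ≡ᵇ x
  ... | true  = cong (isMaxOf n ℓ x a ∧_) (Boolₚ.∧-zeroʳ b)
  ... | false = cong (λ u → isMaxOf n ℓ x a ∧ (isOpen n λ₀ j ∧ u))
                     (anyTo-cong n (λ i p → cong (isMaxOf n ℓ j i ∧_)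
                       (trans (cong ((a <ᵇ i) ∧_) (<ᵇ-intro p)) (Boolₚ.∧-identityʳ _))))

  openAfter-own : ∀ a → isMaxOf n ℓ x a ≡ true → openAfter a x ≡ false
  openAfter-own a m = ∧-falseʳ (isOpen n λ₀ x) (anyTo-false n (λ i _ → not-after i))
    where
    not-after : ∀ i → (isMaxOf n ℓ x i ∧ (a <ᵇ i)) ≡ false
    not-after i with isMaxOf n ℓ x i in e
    ... | false = refl
    ... | true rewrite isMaxOf-unique n ℓ x a i m e = <ᵇ-false (≤-refl {i})

  count-newArc : ∀ a → countTo (suc n) (pair' a n) ≡ ⟦ isMaxOf n ℓ x a ⟧ * openBlocksAfter a
  count-newArc a = trans (countTo-cong (suc n) (pair-newArc a)) (by-cases (isMaxOf n ℓ x a) refl)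
    where
    by-cases : ∀ v → isMaxOf n ℓ x a ≡ v →
               countTo (suc n) (λ j → v ∧ (if j ≡ᵇ x then false else openAfter a j)) ≡ ⟦ v ⟧ * openBlocksAfter a
    by-cases false _ = countTo-zero (suc n) (λ _ _ → refl)
    by-cases true  m = begin
        countTo (suc n) (λ j → if j ≡ᵇ x then false else openAfter a j)
      ≡⟨ sym (+-identityʳ _) ⟩
        countTo (suc n) (λ j → if j ≡ᵇ x then false else openAfter a j) + 0
      ≡⟨ cong (λ u → countTo (suc n) (λ j → if j ≡ᵇ x then false else openAfter a j) + ⟦ u ⟧)
              (sym (openAfter-own a m)) ⟩
        countTo (suc n) (λ j → if j ≡ᵇ x then false else openAfter a j) + ⟦ openAfter a x ⟧
      ≡⟨ countTo-update (suc n) x false (openAfter a) x<1+n ⟩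
        openBlocksAfter a + ⟦ openAfter a n ⟧ + 0
      ≡⟨ cong (λ u → openBlocksAfter a + ⟦ u ⟧ + 0) (∧-falseˡ _ isOpen-n) ⟩
        openBlocksAfter a + 0 + 0
      ≡⟨ +-identityʳ _ ⟩
        1 * openBlocksAfter a
      ∎
      where open ≡-Reasoning

  arcOpen-extend : arcOpen (suc n) λ₁ + lostPairs ≡ arcOpen n λ₀ + newPairs
  arcOpen-extend = begin
      arcOpen (suc n) λ₁ + lostPairs
    ≡⟨ cong (_+ lostPairs) (sumTo-dropLast n (λ a → sumTo (suc n) (λ c → countTo (suc n) (pair' a c)))
         (sumTo-zero (suc n) (λ c p → countTo-zero (suc n) (λ j _ → ∧-falseˡ _ (isArc-from-n c p))))) ⟩
      sumTo n (λ a → sumTo n (λ c → countTo (suc n) (pair' a c)) + countTo (suc n) (pair' a n)) + lostPairs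
    ≡⟨ cong (_+ lostPairs) (sumTo-+ n _ _) ⟩
      sumTo n (λ a → sumTo n (λ c → countTo (suc n) (pair' a c))) + sumTo n (λ a → countTo (suc n) (pair' a n)) + lostPairs
    ≡⟨ swap₂ (sumTo n (λ a → sumTo n (λ c → countTo (suc n) (pair' a c))))
             (sumTo n (λ a → countTo (suc n) (pair' a n))) lostPairs ⟩
      sumTo n (λ a → sumTo n (λ c → countTo (suc n) (pair' a c))) + lostPairs + sumTo n (λ a → countTo (suc n) (pair' a n))
    ≡⟨ cong₂ _+_ old-arcs (sumTo-cong n (λ a _ → count-newArc a)) ⟩
      arcOpen n λ₀ + newPairs
    ∎
    where
    open ≡-Reasoning
    swap₂ : ∀ u v w → u + v + w ≡ u + w + v
    swap₂ = solve-∀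
    old-arcs : sumTo n (λ a → sumTo n (λ c → countTo (suc n) (pair' a c))) + lostPairs ≡ arcOpen n λ₀
    old-arcs = trans (sym (sumTo-+ n _ _))
                     (sumTo-cong n (λ a _ → trans (sym (sumTo-+ n _ _)) (sumTo-cong n (λ c pc → count-oldArc a c pc))))

  -- When block x was open (or is new) the lost pairs are exactly the new
  -- crossings: both count old arcs (a , c) with a < max x < c.
  lostPairs≡newCrossings : (isOpen n λ₀ x ≡ true) ⊎ (x ≡ nb) → lostPairs ≡ newCrossings
  lostPairs≡newCrossings (inj₂ refl) =
    trans (sumTo-zero n (λ a _ → sumTo-zero n (λ c _ → cong ⟦_⟧ (∧-falseʳ (isArc n ℓ a c) (∧-falseˡ _ not-a-block)))))
          (sym (sumTo-zero n (λ a _ → sumTo-zero n (λ c _ → sumTo-zero n (λ i pi →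
                 cong ⟦_⟧ (∧-falseʳ (isArc n ℓ a c) (∧-falseˡ _ (no-max i pi))))))))
    where
    not-a-block : isOpen n λ₀ x ≡ false
    not-a-block = ∧-falseˡ (atB mk x) (<ᵇ-false (≤-refl {x}))
    no-max : ∀ i → i < n → isMaxOf n ℓ x i ≡ false
    no-max i pi with isMaxOf n ℓ x i in e
    ... | false = refl
    ... | true  = ⊥-elim (<-irrefl (sym (isMaxOf-label n ℓ x i e)) (label< i pi))
  lostPairs≡newCrossings (inj₁ open-x) = sumTo-cong n (λ a _ → sumTo-cong n (λ c pc → per-arc a c pc))
    where
    per-arc : ∀ a c → c < n → ⟦ pair a c x ⟧
              ≡ sumTo n (λ i → ⟦ isArc n ℓ a c ∧ isMaxOf n ℓ x i ∧ (a <ᵇ i) ∧ (i <ᵇ c) ∧ (c <ᵇ n) ⟧)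
    per-arc a c pc rewrite open-x = begin
        ⟦ isArc n ℓ a c ∧ anyTo n (λ i → isMaxOf n ℓ x i ∧ (a <ᵇ i) ∧ (i <ᵇ c)) ⟧
      ≡⟨ ⟦∧⟧ (isArc n ℓ a c) _ ⟩
        ⟦ isArc n ℓ a c ⟧ * ⟦ anyTo n (λ i → isMaxOf n ℓ x i ∧ (a <ᵇ i) ∧ (i <ᵇ c)) ⟧
      ≡⟨ cong (⟦ isArc n ℓ a c ⟧ *_)
              (trans (anyTo-count n (λ i i' _ _ u v → isMaxOf-unique n ℓ x i i' (∧-elimˡ u) (∧-elimˡ v)))
                     (countTo-sum n _)) ⟩
        ⟦ isArc n ℓ a c ⟧ * sumTo n (λ i → ⟦ isMaxOf n ℓ x i ∧ (a <ᵇ i) ∧ (i <ᵇ c) ⟧)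
      ≡⟨ sym (sumTo-*ˡ n ⟦ isArc n ℓ a c ⟧ _) ⟩
        sumTo n (λ i → ⟦ isArc n ℓ a c ⟧ * ⟦ isMaxOf n ℓ x i ∧ (a <ᵇ i) ∧ (i <ᵇ c) ⟧)
      ≡⟨ sumTo-cong n (λ i _ → trans (sym (⟦∧⟧ (isArc n ℓ a c) _))
                                     (cong (λ u → ⟦ isArc n ℓ a c ∧ isMaxOf n ℓ x i ∧ (a <ᵇ i) ∧ u ⟧)
                                           (sym (trans (cong ((i <ᵇ c) ∧_) (<ᵇ-intro pc)) (Boolₚ.∧-identityʳ _))))) ⟩
        sumTo n (λ i → ⟦ isArc n ℓ a c ∧ isMaxOf n ℓ x i ∧ (a <ᵇ i) ∧ (i <ᵇ c) ∧ (c <ᵇ n) ⟧)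
      ∎
      where open ≡-Reasoning

  weight-extend : (isOpen n λ₀ x ≡ true) ⊎ (x ≡ nb) → weight (suc n) λ₁ ≡ weight n λ₀ + newPairs
  weight-extend h = +-cancelʳ-≡ lostPairs _ _ (begin
      crossings (suc n) ℓ' + arcOpen (suc n) λ₁ + lostPairs
    ≡⟨ +-assoc (crossings (suc n) ℓ') _ _ ⟩
      crossings (suc n) ℓ' + (arcOpen (suc n) λ₁ + lostPairs)
    ≡⟨ cong₂ _+_ crossings-extend arcOpen-extend ⟩
      crossings n ℓ + newCrossings + (arcOpen n λ₀ + newPairs)
    ≡⟨ cong (λ u → crossings n ℓ + u + (arcOpen n λ₀ + newPairs)) (sym (lostPairs≡newCrossings h)) ⟩
      crossings n ℓ + lostPairs + (arcOpen n λ₀ + newPairs)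
    ≡⟨ shuffle (crossings n ℓ) lostPairs (arcOpen n λ₀) newPairs ⟩
      crossings n ℓ + arcOpen n λ₀ + newPairs + lostPairs
    ∎)
    where
    open ≡-Reasoning
    shuffle : ∀ u v w z → u + v + (w + z) ≡ u + w + z + v
    shuffle = solve-∀

eqZ : ℕ → ℤ → Bool
eqZ k A = ⌊ ⁺ k ℤ.≟ A ⌋

eqZ-intro : ∀ {k A} → ⁺ k ≡ A → eqZ k A ≡ true
eqZ-intro {k} {A} p with ⁺ k ℤ.≟ A
... | yes _ = refl
... | no q  = ⊥-elim (q p)

eqZ-false : ∀ {k A} → ⁺ k ≢ A → eqZ k A ≡ false
eqZ-false {k} {A} p with ⁺ k ℤ.≟ A
... | yes q = ⊥-elim (p q)
... | no q  = refl

eqZ-elim : ∀ {k A} → eqZ k A ≡ true → ⁺ k ≡ A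
eqZ-elim {k} {A} e with ⁺ k ℤ.≟ A
... | yes q = q

⁺-suc : ∀ o → ⁺ suc o ≡ ⁺ o +ℤ 1ℤ
⁺-suc o = trans (cong ⁺_ (+-comm 1 o)) (ℤₚ.pos-+ o 1)

eqZ-pred : ∀ o A → eqZ o (A -ℤ 1ℤ) ≡ eqZ (suc o) A
eqZ-pred o A = bool-ext (λ e → eqZ-intro (to (eqZ-elim e))) (λ e → eqZ-intro (from (eqZ-elim e)))
  where
  to : ⁺ o ≡ A -ℤ 1ℤ → ⁺ suc o ≡ A
  to p = trans (⁺-suc o) (trans (cong (_+ℤ 1ℤ) p)
               (trans (ℤₚ.+-assoc A (ℤ.- 1ℤ) 1ℤ) (ℤₚ.+-identityʳ A)))
  from : ⁺ suc o ≡ A → ⁺ o ≡ A -ℤ 1ℤ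
  from p = trans (sym (trans (ℤₚ.+-assoc (⁺ o) 1ℤ (ℤ.- 1ℤ)) (ℤₚ.+-identityʳ (⁺ o))))
                 (cong (_-ℤ 1ℤ) (trans (sym (⁺-suc o)) p))

eqZ-shift : ∀ w j B → eqZ w (B -ℤ ⁺ j) ≡ eqZ (w + j) B
eqZ-shift w j B = bool-ext (λ e → eqZ-intro (to (eqZ-elim e))) (λ e → eqZ-intro (from (eqZ-elim e)))
  where
  to : ⁺ w ≡ B -ℤ ⁺ j → ⁺ (w + j) ≡ B
  to p = trans (ℤₚ.pos-+ w j) (trans (cong (_+ℤ ⁺ j) p)
               (trans (ℤₚ.+-assoc B (ℤ.- (⁺ j)) (⁺ j))
                      (trans (cong (B +ℤ_) (ℤₚ.+-inverseˡ (⁺ j))) (ℤₚ.+-identityʳ B))))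
  from : ⁺ (w + j) ≡ B → ⁺ w ≡ B -ℤ ⁺ j
  from p = trans (sym (trans (ℤₚ.+-assoc (⁺ w) (⁺ j) (ℤ.- (⁺ j)))
                             (trans (cong (⁺ w +ℤ_) (ℤₚ.+-inverseʳ (⁺ j))) (ℤₚ.+-identityʳ (⁺ w)))))
                 (cong (_-ℤ ⁺ j) (trans (sym (ℤₚ.pos-+ w j)) p))

sumZ-zero : ∀ A (g : ℤ → ℕ) → (∀ j → g j ≡ 0) → sumZ A g ≡ 0
sumZ-zero (⁺ m)    g h = sumTo-zero (suc m) (λ i _ → h (⁺ i))
sumZ-zero -[1+ m ] g h = refl

sumZ-cong : ∀ A {g h : ℤ → ℕ} → (∀ j → g j ≡ h j) → sumZ A g ≡ sumZ A h
sumZ-cong (⁺ m)    e = sumTo-cong (suc m) (λ i _ → e (⁺ i))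
sumZ-cong -[1+ m ] e = refl

sumZ-sumL : {X : Set} (A : ℤ) (L : List X) (h : ℤ → X → ℕ) →
            sumZ A (λ j → sumL L (h j)) ≡ sumL L (λ x → sumZ A (λ j → h j x))
sumZ-sumL (⁺ m)    L h = sym (sumL-sumTo L (suc m) (λ x i → h (⁺ i) x))
sumZ-sumL -[1+ m ] L h = sym (sumL-zero L)

hits : ℕ → ℕ → ℤ → ℕ
hits o w B = sumTo o (λ k → ⟦ eqZ (w + k) B ⟧)

-- The third term of the recurrence, for a single partition: closing one
-- of its o = A + 1 open blocks.
sumZ-closing : ∀ o w A B → sumZ A (λ j → ⟦ eqZ o (A +ℤ 1ℤ) ∧ eqZ w (B -ℤ j) ⟧) ≡ ⟦ eqZ (pred o) A ⟧ * hits o w B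
sumZ-closing o w -[1+ k ] B rewrite eqZ-false {pred o} { -[1+ k ]} (λ ()) = refl
sumZ-closing o w (⁺ a) B with o ≟ suc a
... | yes refl rewrite eqZ-intro {suc a} {⁺ a +ℤ 1ℤ} (⁺-suc a) | eqZ-intro {a} {⁺ a} refl =
  trans (sumTo-cong (suc a) (λ j _ → cong ⟦_⟧ (eqZ-shift w j B))) (sym (+-identityʳ _))
... | no o≢ rewrite eqZ-false {o} {⁺ a +ℤ 1ℤ} (λ p → o≢ (ℤₚ.+-injective (trans p (sym (⁺-suc a))))) =
  trans (sumTo-zero (suc a) (λ _ _ → refl)) (sym (other-o o o≢))
  where
  other-o : ∀ o → o ≢ suc a → ⟦ eqZ (pred o) (⁺ a) ⟧ * hits o w B ≡ 0
  other-o zero     _   = *-zeroʳ ⟦ eqZ 0 (⁺ a) ⟧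
  other-o (suc o') o≢' rewrite eqZ-false {o'} {⁺ a} (λ p → o≢' (cong suc (ℤₚ.+-injective p))) = refl

-- The fourth term: keeping one of its o = A open blocks open.
sumZ-keeping : ∀ o w A B → sumZ (A -ℤ 1ℤ) (λ j → ⟦ eqZ o A ∧ eqZ w (B -ℤ j) ⟧) ≡ ⟦ eqZ o A ⟧ * hits o w B
sumZ-keeping o w A B with ⁺ o ℤ.≟ A
... | no _     = sumZ-zero (A -ℤ 1ℤ) _ (λ _ → refl)
... | yes refl = ranks o
  where
  ranks : ∀ o → sumZ (⁺ o -ℤ 1ℤ) (λ j → ⟦ true ∧ eqZ w (B -ℤ j) ⟧) ≡ 1 * hits o w B
  ranks zero     = refl
  ranks (suc o') = trans (sumTo-cong (suc o') (λ j _ → cong ⟦_⟧ (eqZ-shift w j B))) (sym (+-identityʳ _))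

-- Rank lemma: give each selected position m < N (q m) the rank "number
-- of selected positions after m".  The ranks run through 0,…,count-1, so
-- testing w + rank against B is the same as counting hits.
sum-over-ranks : ∀ N (q : ℕ → Bool) w B →
                 sumTo N (λ m → ⟦ q m ∧ eqZ (w + countTo N (λ i → q i ∧ (m <ᵇ i))) B ⟧) ≡ hits (countTo N q) w B
sum-over-ranks zero    q w B = refl
sum-over-ranks (suc N) q w B with q N
... | false =
  trans (+-identityʳ _)
  (trans (sumTo-cong N (λ m p → cong (λ u → ⟦ q m ∧ eqZ (w + u) B ⟧) (+-identityʳ _)))
  (trans (sum-over-ranks N q w B) (cong (λ u → hits u w B) (sym (+-identityʳ (countTo N q))))))
... | true = begin
    sumTo N (λ m → ⟦ q m ∧ eqZ (w + (countTo N (λ i → q i ∧ (m <ᵇ i)) + ⟦ true ∧ (m <ᵇ N) ⟧)) B ⟧)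
      + ⟦ true ∧ eqZ (w + (countTo N (λ i → q i ∧ (N <ᵇ i)) + ⟦ true ∧ (N <ᵇ N) ⟧)) B ⟧
  ≡⟨ cong₂ _+_ (sumTo-cong N (λ m p → cong (λ u → ⟦ q m ∧ eqZ u B ⟧) (earlier m p)))
               (cong (λ u → ⟦ eqZ u B ⟧) last) ⟩
    sumTo N (λ m → ⟦ q m ∧ eqZ (suc w + countTo N (λ i → q i ∧ (m <ᵇ i))) B ⟧) + ⟦ eqZ (w + 0) B ⟧
  ≡⟨ cong (_+ ⟦ eqZ (w + 0) B ⟧) (sum-over-ranks N q (suc w) B) ⟩
    hits (countTo N q) (suc w) B + ⟦ eqZ (w + 0) B ⟧
  ≡⟨ +-comm (hits (countTo N q) (suc w) B) _ ⟩
    ⟦ eqZ (w + 0) B ⟧ + sumTo (countTo N q) (λ k → ⟦ eqZ (suc w + k) B ⟧)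
  ≡⟨ cong (⟦ eqZ (w + 0) B ⟧ +_)
          (sumTo-cong (countTo N q) (λ k _ → cong (λ u → ⟦ eqZ u B ⟧) (sym (+-suc w k)))) ⟩
    ⟦ eqZ (w + 0) B ⟧ + sumTo (countTo N q) (λ k → ⟦ eqZ (w + suc k) B ⟧)
  ≡⟨ sym (sumTo-shift (countTo N q) (λ k → ⟦ eqZ (w + k) B ⟧)) ⟩
    hits (suc (countTo N q)) w B
  ≡⟨ cong (λ u → hits u w B) (+-comm 1 (countTo N q)) ⟩
    hits (countTo N q + ⟦ true ⟧) w B
  ∎
  where
  open ≡-Reasoning
  -- a selected position before N gains the new position N as a later one
  earlier : ∀ m → m < N → w + (countTo N (λ i → q i ∧ (m <ᵇ i)) + ⟦ true ∧ (m <ᵇ N) ⟧)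
                          ≡ suc w + countTo N (λ i → q i ∧ (m <ᵇ i))
  earlier m p rewrite <ᵇ-intro p = trans (cong (w +_) (+-comm _ 1)) (+-suc w _)
  -- the new position N has rank 0
  last : w + (countTo N (λ i → q i ∧ (N <ᵇ i)) + ⟦ true ∧ (N <ᵇ N) ⟧) ≡ w + 0
  last rewrite countTo-zero N {λ i → q i ∧ (N <ᵇ i)} (λ i p → ∧-falseʳ (q i) (<ᵇ-false (<⇒≤ p)))
             | <ᵇ-false {N} {N} ≤-refl = refl

-- The admissible targets for the new position are the new block
-- (label numBlocks ℓ) and the open blocks, listed through their maxima;
-- each comes with the two possible marks.

targets : ℕ → MSP → List ℕ
targets n (ℓ , mk) = numBlocks ℓ ∷ map (at ℓ) (filterB (isBlockMax n ℓ (isOpen n (ℓ , mk))) (upTo n))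

choices : ℕ → MSP → List (ℕ × Bool)
choices n λ₀ = concatMap (λ y → map (y ,_) bools) (targets n λ₀)

extensions : ℕ → List MSP
extensions n = concatMap (λ λ₀ → map (extend n λ₀) (choices n λ₀)) (allMSP n)

canonMarks-elim : ∀ n ℓ mk → length mk ≡ n → canonMarks n ℓ mk ≡ true → ∀ j → numBlocks ℓ ≤ j → atB mk j ≡ false
canonMarks-elim n ℓ mk len c j p with j <? n
... | no q = atB-beyond mk j (subst (_≤ j) (sym len) (≮⇒≥ q))
... | yes q with allTo-elim n c j q
... | e rewrite <ᵇ-false {j} {numBlocks ℓ} p with atB mk j
...   | false = refl

canonMarks-intro : ∀ n ℓ mk → (∀ j → j < n → numBlocks ℓ ≤ j → atB mk j ≡ false) → canonMarks n ℓ mk ≡ true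
canonMarks-intro n ℓ mk h = allTo-intro n closed
  where
  closed : ∀ j → j < n → ((j <ᵇ numBlocks ℓ) ∨ not (atB mk j)) ≡ true
  closed j p with j <? numBlocks ℓ
  ... | yes q rewrite <ᵇ-intro q = refl
  ... | no q rewrite <ᵇ-false {j} {numBlocks ℓ} (≮⇒≥ q) | h j p (≮⇒≥ q) = refl

record ValidFacts (n : ℕ) (ℓ : List ℕ) (mk : List Bool) : Set where
  field
    length-ℓ  : length ℓ ≡ n
    length-mk : length mk ≡ n
    rgf       : isRGF ℓ ≡ true
    blocks    : RGFfacts n ℓ
    canonical : ∀ j → numBlocks ℓ ≤ j → atB mk j ≡ false

validFacts : ∀ n ℓ mk → Valid n (ℓ , mk) → ValidFacts n ℓ mk
validFacts n ℓ mk (a , b , c , v) = record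
  { length-ℓ  = a
  ; length-mk = c
  ; rgf       = ∧-elimˡ v
  ; blocks    = rgfFacts n ℓ a (∧-elimˡ v)
  ; canonical = canonMarks-elim n ℓ mk c (∧-elimʳ {isRGF ℓ} v) }

isOpen-isBlock : ∀ n ℓ mk j → isOpen n (ℓ , mk) j ≡ true → j < numBlocks ℓ
isOpen-isBlock n ℓ mk j e = <ᵇ-elim (∧-elimˡ e)

targets-∈ : ∀ n ℓ mk x → x ∈ targets n (ℓ , mk) →
            (x ≡ numBlocks ℓ) ⊎ (∃[ m ] (m < n × isBlockMax n ℓ (isOpen n (ℓ , mk)) m ≡ true × at ℓ m ≡ x))
targets-∈ n ℓ mk x (here refl) = inj₁ refl
targets-∈ n ℓ mk x (there p) with ∈-map⁻ (at ℓ) p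
... | m , pm , refl = let (a , b) = ∈-filterB⁻ (isBlockMax n ℓ (isOpen n (ℓ , mk))) (upTo n) pm
                      in inj₂ (m , ∈-upTo⁻ a , b , refl)

target-open : ∀ n ℓ mk x → x ∈ targets n (ℓ , mk) → (isOpen n (ℓ , mk) x ≡ true) ⊎ (x ≡ numBlocks ℓ)
target-open n ℓ mk x p with targets-∈ n ℓ mk x p
... | inj₁ e                 = inj₂ e
... | inj₂ (m , _ , q , refl) = inj₁ (∧-elimˡ q)

target-≤ : ∀ n ℓ mk x → x ∈ targets n (ℓ , mk) → x ≤ numBlocks ℓ
target-≤ n ℓ mk x p with target-open n ℓ mk x p
... | inj₁ o    = <⇒≤ (isOpen-isBlock n ℓ mk x o)
... | inj₂ refl = ≤-refl

choices-∈ : ∀ n λ₀ c → c ∈ choices n λ₀ → proj₁ c ∈ targets n λ₀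
choices-∈ n λ₀ c p with find (∈-concatMap⁻ (λ y → map (y ,_) bools) {xs = targets n λ₀} p)
... | y , py , q with ∈-map⁻ (y ,_) q
... | _ , _ , refl = py

extend-valid : ∀ n ℓ mk x b → Valid n (ℓ , mk) → x ∈ targets n (ℓ , mk) → Valid (suc n) (extend n (ℓ , mk) (x , b))
extend-valid n ℓ mk x b V@(_ , labels<n , _ , _) px =
    trans (length-snoc ℓ x) (cong suc length-ℓ)
  , Allₚ.++⁺ (All.map m<n⇒m<1+n labels<n) (x<1+n ∷ [])
  , length-applyUpTo (λ j → if j ≡ᵇ x then b else atB mk j) (suc n)
  , ∧-intro (trans (isRGF-snoc ℓ x) (∧-intro rgf (<ᵇ-intro (s≤s x≤))))
            (canonMarks-intro (suc n) ℓ' mk' closed)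
  where
  open ValidFacts (validFacts n ℓ mk V)
  x≤ = target-≤ n ℓ mk x px
  open Extension n ℓ mk x b length-ℓ blocks x≤
  closed : ∀ j → j < suc n → numBlocks ℓ' ≤ j → atB mk' j ≡ false
  closed j p q with j ≟ x
  ... | yes refl = ⊥-elim (<⇒≱ x-isBlock q)
  ... | no j≢x rewrite atB-applyUpTo (suc n) (λ j → if j ≡ᵇ x then b else atB mk j) j p | ≡ᵇ-false j≢x =
    canonical j (≤-trans (subst (nb ≤_) (sym (numBlocks-snoc ℓ x)) (nextBlocks-≥ nb x)) q)

-- Deleting the last position: a left inverse of extension.  Block x,
-- which the last position joined, regains its old mark: open exactly if
-- it is not the new block (extension only joins open blocks).
restrict : MSP → MSP
restrict (ℓ' , mk') =
  initL ℓ' ,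
  applyUpTo (λ j → if j ≡ᵇ lastL ℓ' then (lastL ℓ' <ᵇ numBlocks (initL ℓ')) else atB mk' j) (pred (length ℓ'))

restrict-extend : ∀ n ℓ mk x b → Valid n (ℓ , mk) → x ∈ targets n (ℓ , mk) →
                  restrict (extend n (ℓ , mk) (x , b)) ≡ (ℓ , mk)
restrict-extend n ℓ mk x b V px
  rewrite initL-snoc ℓ x | lastL-snoc ℓ x | length-snoc ℓ x | ValidFacts.length-ℓ (validFacts n ℓ mk V) =
  cong (ℓ ,_) (atB-ext (applyUpTo h n) mk (trans (length-applyUpTo h n) (sym length-mk))
                       (λ j p → same j (subst (j <_) (length-applyUpTo h n) p)))
  where
  open ValidFacts (validFacts n ℓ mk V)
  g : ℕ → Bool
  g j = if j ≡ᵇ x then b else atB mk j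
  h : ℕ → Bool
  h j = if j ≡ᵇ x then (x <ᵇ numBlocks ℓ) else atB (applyUpTo g (suc n)) j
  same : ∀ j → j < n → atB (applyUpTo h n) j ≡ atB mk j
  same j p rewrite atB-applyUpTo n h j p with j ≟ x
  ... | yes refl rewrite ≡ᵇ-refl j = case target-open n ℓ mk j px of λ
    { (inj₁ o)    → trans (<ᵇ-intro (isOpen-isBlock n ℓ mk j o)) (sym (∧-elimʳ {j <ᵇ numBlocks ℓ} o))
    ; (inj₂ refl) → trans (<ᵇ-false {numBlocks ℓ} {numBlocks ℓ} ≤-refl) (sym (canonical j ≤-refl)) }
  ... | no j≢x rewrite ≡ᵇ-false j≢x | atB-applyUpTo (suc n) g j (m<n⇒m<1+n p) | ≡ᵇ-false j≢x = refl

unique-targets : ∀ n ℓ mk → Unique (targets n (ℓ , mk))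
unique-targets n ℓ mk =
  All.tabulate new-not-old ∷ unique-map (at ℓ) (filterB isMaxOpen (upTo n)) same-block
                                        (unique-filterB isMaxOpen (upTo n) (Uniqueₚ.upTo⁺ n))
  where
  isMaxOpen = isBlockMax n ℓ (isOpen n (ℓ , mk))
  new-not-old : ∀ {y} → y ∈ map (at ℓ) (filterB isMaxOpen (upTo n)) → numBlocks ℓ ≢ y
  new-not-old p e with ∈-map⁻ (at ℓ) p
  ... | m , pm , refl =
    <-irrefl (sym e) (isOpen-isBlock n ℓ mk (at ℓ m) (∧-elimˡ (proj₂ (∈-filterB⁻ isMaxOpen (upTo n) pm))))
  same-block : ∀ a c → a ∈ filterB isMaxOpen (upTo n) → c ∈ filterB isMaxOpen (upTo n) → at ℓ a ≡ at ℓ c → a ≡ c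
  same-block a c pa pc e =
    isMaxOf-unique n ℓ (at ℓ a) a c (∧-elimʳ {isOpen n (ℓ , mk) (at ℓ a)} qa)
                   (subst (λ z → isMaxOf n ℓ z c ≡ true) (sym e) (∧-elimʳ {isOpen n (ℓ , mk) (at ℓ c)} qc))
    where qa = proj₂ (∈-filterB⁻ isMaxOpen (upTo n) pa)
          qc = proj₂ (∈-filterB⁻ isMaxOpen (upTo n) pc)

unique-choices : ∀ n λ₀ → Unique (choices n λ₀)
unique-choices n (ℓ , mk) =
  unique-concatMap (λ y → map (y ,_) bools) proj₁ (targets n (ℓ , mk)) (unique-targets n ℓ mk)
    (λ y _ → ((λ ()) ∷ []) ∷ [] ∷ [])
    (λ y c _ m → case ∈-map⁻ (y ,_) m of λ { (_ , _ , refl) → refl })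

unique-extend : ∀ n ℓ mk → Valid n (ℓ , mk) → Unique (map (extend n (ℓ , mk)) (choices n (ℓ , mk)))
unique-extend n ℓ mk V = unique-map (extend n (ℓ , mk)) (choices n (ℓ , mk)) injective (unique-choices n (ℓ , mk))
  where
  mark-of-x : ∀ x b → x < suc n → atB (extendMarks n mk x b) x ≡ b
  mark-of-x x b x<1+n =
    trans (atB-applyUpTo (suc n) (λ j → if j ≡ᵇ x then b else atB mk j) x x<1+n)
          (cong (λ u → if u then b else atB mk x) (≡ᵇ-refl x))
  injective : ∀ c c' → c ∈ choices n (ℓ , mk) → c' ∈ choices n (ℓ , mk) →
              extend n (ℓ , mk) c ≡ extend n (ℓ , mk) c' → c ≡ c'
  injective (x , b) (x' , b') pc pc' e with ∷ʳ-injective ℓ ℓ (cong proj₁ e)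
  ... | _ , refl = cong (x ,_) (trans (sym (mark-of-x x b x<1+n))
                                      (trans (cong (λ p → atB (proj₂ p) x) e) (mark-of-x x b' x<1+n)))
    where
    x<1+n : x < suc n
    x<1+n = s≤s (≤-trans (target-≤ n ℓ mk x (choices-∈ n (ℓ , mk) (x , b) pc))
                         (RGFfacts.numBlocks≤ (ValidFacts.blocks (validFacts n ℓ mk V))))

unique-extensions : ∀ n → Unique (extensions n)
unique-extensions n =
  unique-concatMap (λ λ₀ → map (extend n λ₀) (choices n λ₀)) restrict (allMSP n) (unique-allMSP n)
    (λ { (ℓ , mk) p → unique-extend n ℓ mk (allMSP-∈⁻ n (ℓ , mk) p) })
    (λ { (ℓ , mk) y p q → case ∈-map⁻ (extend n (ℓ , mk)) q of λ
         { ((x , b) , pc , refl) →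
             restrict-extend n ℓ mk x b (allMSP-∈⁻ n (ℓ , mk) p) (choices-∈ n (ℓ , mk) (x , b) pc) } })

extensions-sound : ∀ n μ → μ ∈ extensions n → μ ∈ allMSP (suc n)
extensions-sound n μ p with find (∈-concatMap⁻ (λ λ₀ → map (extend n λ₀) (choices n λ₀)) {xs = allMSP n} p)
... | (ℓ , mk) , pλ , q with ∈-map⁻ (extend n (ℓ , mk)) q
... | (x , b) , pc , refl =
  allMSP-∈⁺ (suc n) _ (extend-valid n ℓ mk x b (allMSP-∈⁻ n (ℓ , mk) pλ) (choices-∈ n (ℓ , mk) (x , b) pc))

-- Conversely, a valid partition of [n+1] is an extension of its
-- restriction to [n]: the last position joins block x, and the old mark
-- of block x is "open" unless x is the new block.
module Restriction (n : ℕ) (ℓ : List ℕ) (x : ℕ) (mk' : List Bool)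
                   (V' : Valid (suc n) (ℓ ++ [ x ] , mk')) (length-ℓ : length ℓ ≡ n) where
  open ValidFacts (validFacts (suc n) (ℓ ++ [ x ]) mk' V')
    using (length-mk) renaming (rgf to rgf'; canonical to canonical')

  rgf-and-x : (isRGF ℓ ∧ (x <ᵇ suc (numBlocks ℓ))) ≡ true
  rgf-and-x = trans (sym (isRGF-snoc ℓ x)) rgf'

  x≤ : x ≤ numBlocks ℓ
  x≤ = ≤-pred (<ᵇ-elim (∧-elimʳ {isRGF ℓ} rgf-and-x))

  open RGFfacts (rgfFacts n ℓ length-ℓ (∧-elimˡ rgf-and-x))

  nb : ℕ
  nb = numBlocks ℓ

  oldMark : ℕ → Bool
  oldMark j = if j ≡ᵇ x then (x <ᵇ nb) else atB mk' j

  mk : List Bool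
  mk = applyUpTo oldMark n

  closed' : ∀ j → nb ≤ j → j ≢ x → atB mk' j ≡ false
  closed' j p j≢x = canonical' j (subst (_≤ j) (sym (numBlocks-snoc ℓ x)) (beyond (x ≟ nb)))
    where
    beyond : Dec (x ≡ nb) → nextBlocks nb x ≤ j
    beyond (yes refl) rewrite nextBlocks-new x = ≤∧≢⇒< p (j≢x ∘ sym)
    beyond (no q)     rewrite nextBlocks-old nb x q = p

  valid : Valid n (ℓ , mk)
  valid = length-ℓ
        , at-all ℓ (λ i p → <-≤-trans (label< i (subst (i <_) length-ℓ p)) numBlocks≤)
        , length-applyUpTo oldMark n
        , ∧-intro (∧-elimˡ rgf-and-x) (canonMarks-intro n ℓ mk (λ j p q → trans (atB-applyUpTo n oldMark j p) (closed j q)))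
    where
    closed : ∀ j → nb ≤ j → oldMark j ≡ false
    closed j q with j ≟ x
    ... | yes refl rewrite ≡ᵇ-refl j = <ᵇ-false q
    ... | no j≢x rewrite ≡ᵇ-false j≢x = closed' j q j≢x

  target : x ∈ targets n (ℓ , mk)
  target with x ≟ nb
  ... | yes refl = here refl
  ... | no x≢nb with occupied x (≤∧≢⇒< x≤ x≢nb)
  ...   | i , i<n , ℓi≡x with isMaxOf-exists n ℓ x i i<n ℓi≡x
  ...     | m , max-m =
    there (subst (_∈ map (at ℓ) (filterB isMaxOpen (upTo n))) label-m
                 (∈-map⁺ (at ℓ) (∈-filterB⁺ isMaxOpen (upTo n) (∈-upTo⁺ m<n) maxOpen-m)))
    where
    isMaxOpen = isBlockMax n ℓ (isOpen n (ℓ , mk))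
    m<n : m < n
    m<n = proj₁ (isMaxOf-elim n ℓ x m max-m)
    label-m : at ℓ m ≡ x
    label-m = proj₁ (proj₂ (isMaxOf-elim n ℓ x m max-m))
    x<nb : x < nb
    x<nb = ≤∧≢⇒< x≤ x≢nb
    open-x : isOpen n (ℓ , mk) x ≡ true
    open-x = ∧-intro (<ᵇ-intro x<nb)
                     (trans (atB-applyUpTo n oldMark x (<-≤-trans x<nb numBlocks≤))
                            (trans (cong (λ u → if u then (x <ᵇ nb) else atB mk' x) (≡ᵇ-refl x)) (<ᵇ-intro x<nb)))
    maxOpen-m : isMaxOpen m ≡ true
    maxOpen-m = subst (λ z → (isOpen n (ℓ , mk) z ∧ isMaxOf n ℓ z m) ≡ true) (sym label-m) (∧-intro open-x max-m)

  recover : (ℓ ++ [ x ] , mk') ≡ extend n (ℓ , mk) (x , atB mk' x)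
  recover = cong (ℓ ++ [ x ] ,_) (atB-ext mk' (applyUpTo newMark (suc n))
                                          (trans length-mk (sym (length-applyUpTo newMark (suc n)))) same)
    where
    newMark : ℕ → Bool
    newMark j = if j ≡ᵇ x then atB mk' x else atB mk j
    same : ∀ j → j < length mk' → atB mk' j ≡ atB (applyUpTo newMark (suc n)) j
    same j p' with subst (j <_) length-mk p'
    ... | p rewrite atB-applyUpTo (suc n) newMark j p with j ≟ x
    ...   | yes refl rewrite ≡ᵇ-refl j = refl
    ...   | no j≢x rewrite ≡ᵇ-false j≢x with j <? n
    ...     | yes j<n rewrite atB-applyUpTo n oldMark j j<n | ≡ᵇ-false j≢x = refl
    ...     | no j≮n rewrite atB-applyUpTo-≥ n oldMark j (≮⇒≥ j≮n) =
      closed' j (≤-trans numBlocks≤ (≮⇒≥ j≮n)) j≢x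

extensions-complete : ∀ n μ → Valid (suc n) μ → μ ∈ extensions n
extensions-complete n (ℓ' , mk') V' with snoc-view n ℓ' (proj₁ V')
... | ℓ , x , refl , length-ℓ =
  ∈-concatMap⁺ (λ λ₀ → map (extend n λ₀) (choices n λ₀))
    (lose (allMSP-∈⁺ n (ℓ , mk) valid)
          (subst (_∈ map (extend n (ℓ , mk)) (choices n (ℓ , mk))) (sym recover)
                 (∈-map⁺ (extend n (ℓ , mk)) (∈-concatMap⁺ (λ y → map (y ,_) bools)
                                              (lose target (∈-map⁺ (x ,_) (∈-bools (atB mk' x))))))))
  where open Restriction n ℓ x mk' V' length-ℓ

counted : ℕ → ℤ → ℤ → MSP → Bool
counted N A B μ = eqZ (openBlocks N μ) A ∧ eqZ (weight N μ) B

fi-as-sum : ∀ N A B → fi N A B ≡ sumL (allMSP N) (λ μ → ⟦ counted N A B μ ⟧)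
fi-as-sum N A B = length-filterB (counted N A B) (allMSP N)

recurrenceTerms : ℕ → ℕ → ℤ → ℤ → ℕ
recurrenceTerms o w A B =
  ⟦ eqZ o A ∧ eqZ w B ⟧ + ⟦ eqZ o (A -ℤ 1ℤ) ∧ eqZ w B ⟧
  + sumZ A (λ j → ⟦ eqZ o (A +ℤ 1ℤ) ∧ eqZ w (B -ℤ j) ⟧)
  + sumZ (A -ℤ 1ℤ) (λ j → ⟦ eqZ o A ∧ eqZ w (B -ℤ j) ⟧)

indicator-split : ∀ q a c e X → (q ≡ true → X ≡ ⟦ a ⟧ * ⟦ e ⟧ + ⟦ c ⟧ * ⟦ e ⟧) →
                  ⟦ q ⟧ * X ≡ ⟦ a ⟧ * ⟦ q ∧ e ⟧ + ⟦ c ⟧ * ⟦ q ∧ e ⟧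
indicator-split false a c e X h = sym (cong₂ _+_ (*-zeroʳ ⟦ a ⟧) (*-zeroʳ ⟦ c ⟧))
indicator-split true  a c e X h = trans (+-identityʳ X) (h refl)

module Contribution (n : ℕ) (ℓ : List ℕ) (mk : List Bool) (V : Valid n (ℓ , mk)) (A B : ℤ) where
  open ValidFacts (validFacts n ℓ mk V)
  open RGFfacts blocks

  λ₀ : MSP
  λ₀ = ℓ , mk

  o w nb : ℕ
  o  = openBlocks n λ₀
  w  = weight n λ₀
  nb = numBlocks ℓ

  isMaxOpen : ℕ → Bool
  isMaxOpen = isBlockMax n ℓ (isOpen n λ₀)

  rank : ℕ → ℕ
  rank m = countTo n (λ i → isMaxOpen i ∧ (m <ᵇ i))

  label<n : ∀ i → i < n → at ℓ i < n
  label<n i p = <-≤-trans (label< i p) numBlocks≤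

  open-by-maxima : o ≡ countTo n isMaxOpen
  open-by-maxima = begin
      countTo n (isOpen n λ₀)
    ≡⟨ countTo-cong n (λ j _ → has-max j) ⟩
      countTo n (λ j → isOpen n λ₀ j ∧ anyTo n (λ i → isMaxOf n ℓ j i ∧ true))
    ≡⟨ count-by-maxima n ℓ (isOpen n λ₀) label<n (λ _ → true) ⟩
      countTo n (λ i → isMaxOpen i ∧ true)
    ≡⟨ countTo-cong n (λ i _ → Boolₚ.∧-identityʳ (isMaxOpen i)) ⟩
      countTo n isMaxOpen
    ∎
    where
    open ≡-Reasoning
    has-max : ∀ j → isOpen n λ₀ j ≡ (isOpen n λ₀ j ∧ anyTo n (λ i → isMaxOf n ℓ j i ∧ true))
    has-max j with isOpen n λ₀ j in e
    ... | false = refl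
    ... | true with occupied j (isOpen-isBlock n ℓ mk j e)
    ...   | i , i<n , ℓi≡j with isMaxOf-exists n ℓ j i i<n ℓi≡j
    ...     | m , max-m = sym (anyTo-intro n m (proj₁ (isMaxOf-elim n ℓ j m max-m)) (trans (Boolₚ.∧-identityʳ _) max-m))

  counted' : ℕ × Bool → ℕ
  counted' c = ⟦ counted (suc n) A B (extend n λ₀ c) ⟧

  newBlock : ∀ b → counted' (nb , b) ≡ ⟦ eqZ (o + ⟦ b ⟧) A ∧ eqZ w B ⟧
  newBlock b = cong₂ (λ u v → ⟦ eqZ u A ∧ eqZ v B ⟧) opens wt
    where
    open Extension n ℓ mk nb b length-ℓ blocks ≤-refl using (openBlocks-extend; weight-extend; openBlocksAfter)
    opens : openBlocks (suc n) (extend n λ₀ (nb , b)) ≡ o + ⟦ b ⟧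
    opens = trans (sym (+-identityʳ _))
                  (trans (cong (λ u → openBlocks (suc n) (extend n λ₀ (nb , b)) + ⟦ u ⟧)
                               (sym (∧-falseˡ (atB mk nb) (<ᵇ-false {nb} {nb} ≤-refl))))
                         openBlocks-extend)
    no-max : ∀ a → a < n → isMaxOf n ℓ nb a ≡ false
    no-max a pa with isMaxOf n ℓ nb a in e
    ... | false = refl
    ... | true  = ⊥-elim (<-irrefl (sym (isMaxOf-label n ℓ nb a e)) (label< a pa))
    wt : weight (suc n) (extend n λ₀ (nb , b)) ≡ w
    wt = trans (weight-extend (inj₂ refl))
               (trans (cong (w +_) (sumTo-zero n (λ a pa → cong (λ u → ⟦ u ⟧ * openBlocksAfter a) (no-max a pa))))
                      (+-identityʳ w))

  module JoinOpen (m : ℕ) (m<n : m < n) (max-m : isMaxOpen m ≡ true) (b : Bool) where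
    x = at ℓ m
    open-x : isOpen n λ₀ x ≡ true
    open-x = ∧-elimˡ max-m
    m-isMax : isMaxOf n ℓ x m ≡ true
    m-isMax = ∧-elimʳ {isOpen n λ₀ x} max-m
    open Extension n ℓ mk x b length-ℓ blocks (<⇒≤ (isOpen-isBlock n ℓ mk x open-x))
      using (openBlocks-extend; weight-extend; openBlocksAfter)

    opens : openBlocks (suc n) (extend n λ₀ (x , b)) + 1 ≡ o + ⟦ b ⟧
    opens = trans (cong (λ u → openBlocks (suc n) (extend n λ₀ (x , b)) + ⟦ u ⟧) (sym open-x)) openBlocks-extend

    -- only a = m contributes to newPairs, and it contributes the rank of m
    wt : weight (suc n) (extend n λ₀ (x , b)) ≡ w + rank m
    wt = trans (weight-extend (inj₁ open-x)) (cong (w +_) (begin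
        sumTo n (λ a → ⟦ isMaxOf n ℓ x a ⟧ * openBlocksAfter a)
      ≡⟨ sumTo-single n m m<n other-max ⟩
        ⟦ isMaxOf n ℓ x m ⟧ * openBlocksAfter m
      ≡⟨ cong (λ u → ⟦ u ⟧ * openBlocksAfter m) m-isMax ⟩
        openBlocksAfter m + 0
      ≡⟨ +-identityʳ _ ⟩
        openBlocksAfter m
      ≡⟨ count-by-maxima n ℓ (isOpen n λ₀) label<n (m <ᵇ_) ⟩
        rank m
      ∎))
      where
      open ≡-Reasoning
      other-max : ∀ a → a < n → a ≢ m → ⟦ isMaxOf n ℓ x a ⟧ * openBlocksAfter a ≡ 0
      other-max a _ a≢m with isMaxOf n ℓ x a in e
      ... | false = refl
      ... | true  = ⊥-elim (a≢m (isMaxOf-unique n ℓ x a m e m-isMax))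

  joinOpen-keep : ∀ m → m < n → isMaxOpen m ≡ true → counted' (at ℓ m , true) ≡ ⟦ eqZ o A ⟧ * ⟦ eqZ (w + rank m) B ⟧
  joinOpen-keep m m<n max-m =
    trans (cong₂ (λ u v → ⟦ eqZ u A ∧ eqZ v B ⟧) (+-cancelʳ-≡ 1 _ _ opens) wt) (⟦∧⟧ (eqZ o A) _)
    where open JoinOpen m m<n max-m true

  joinOpen-close : ∀ m → m < n → isMaxOpen m ≡ true → counted' (at ℓ m , false) ≡ ⟦ eqZ (pred o) A ⟧ * ⟦ eqZ (w + rank m) B ⟧
  joinOpen-close m m<n max-m =
    trans (cong₂ (λ u v → ⟦ eqZ u A ∧ eqZ v B ⟧)
                 (trans (cong pred (sym (+-comm _ 1))) (cong pred (trans opens (+-identityʳ o)))) wt)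
          (⟦∧⟧ (eqZ (pred o) A) _)
    where open JoinOpen m m<n max-m false

  bothMarks : ℕ → ℕ
  bothMarks y = sumL (map (y ,_) bools) counted'

  joins : sumL (map (at ℓ) (filterB isMaxOpen (upTo n))) bothMarks
          ≡ ⟦ eqZ o A ⟧ * hits o w B + ⟦ eqZ (pred o) A ⟧ * hits o w B
  joins = begin
      sumL (map (at ℓ) (filterB isMaxOpen (upTo n))) bothMarks
    ≡⟨ trans (sumL-map (at ℓ) (filterB isMaxOpen (upTo n)) bothMarks)
             (trans (sumL-filterB isMaxOpen (upTo n) (bothMarks ∘ at ℓ)) (sumL-upTo n _)) ⟩
      sumTo n (λ m → ⟦ isMaxOpen m ⟧ * bothMarks (at ℓ m))
    ≡⟨ sumTo-cong n (λ m m<n → indicator-split (isMaxOpen m) (eqZ o A) (eqZ (pred o) A) (eqZ (w + rank m) B) _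
                                 (λ max-m → cong₂ _+_ (joinOpen-keep m m<n max-m)
                                                      (trans (+-identityʳ _) (joinOpen-close m m<n max-m)))) ⟩
      sumTo n (λ m → ⟦ eqZ o A ⟧ * H m + ⟦ eqZ (pred o) A ⟧ * H m)
    ≡⟨ sumTo-+ n _ _ ⟩
      sumTo n (λ m → ⟦ eqZ o A ⟧ * H m) + sumTo n (λ m → ⟦ eqZ (pred o) A ⟧ * H m)
    ≡⟨ cong₂ _+_ (sumTo-*ˡ n ⟦ eqZ o A ⟧ H) (sumTo-*ˡ n ⟦ eqZ (pred o) A ⟧ H) ⟩
      ⟦ eqZ o A ⟧ * sumTo n H + ⟦ eqZ (pred o) A ⟧ * sumTo n H
    ≡⟨ cong (λ u → ⟦ eqZ o A ⟧ * u + ⟦ eqZ (pred o) A ⟧ * u)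
            (trans (sum-over-ranks n isMaxOpen w B) (cong (λ u → hits u w B) (sym open-by-maxima))) ⟩
      ⟦ eqZ o A ⟧ * hits o w B + ⟦ eqZ (pred o) A ⟧ * hits o w B
    ∎
    where
    open ≡-Reasoning
    H : ℕ → ℕ
    H m = ⟦ isMaxOpen m ∧ eqZ (w + rank m) B ⟧

  contribution : sumL (choices n λ₀) counted' ≡ recurrenceTerms o w A B
  contribution = begin
      sumL (choices n λ₀) counted'
    ≡⟨ sumL-concatMap (λ y → map (y ,_) bools) (targets n λ₀) counted' ⟩
      bothMarks nb + sumL (map (at ℓ) (filterB isMaxOpen (upTo n))) bothMarks
    ≡⟨ cong₂ _+_ (cong₂ (λ u v → u + (v + 0)) new-open new-closed) joins ⟩
      ⟦ eqZ o (A -ℤ 1ℤ) ∧ eqZ w B ⟧ + (⟦ eqZ o A ∧ eqZ w B ⟧ + 0)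
        + (⟦ eqZ o A ⟧ * hits o w B + ⟦ eqZ (pred o) A ⟧ * hits o w B)
    ≡⟨ shuffle ⟦ eqZ o (A -ℤ 1ℤ) ∧ eqZ w B ⟧ ⟦ eqZ o A ∧ eqZ w B ⟧ _ _ ⟩
      ⟦ eqZ o A ∧ eqZ w B ⟧ + ⟦ eqZ o (A -ℤ 1ℤ) ∧ eqZ w B ⟧
        + ⟦ eqZ (pred o) A ⟧ * hits o w B + ⟦ eqZ o A ⟧ * hits o w B
    ≡⟨ sym (cong₂ _+_ (cong (⟦ eqZ o A ∧ eqZ w B ⟧ + ⟦ eqZ o (A -ℤ 1ℤ) ∧ eqZ w B ⟧ +_) (sumZ-closing o w A B))
                      (sumZ-keeping o w A B)) ⟩
      recurrenceTerms o w A B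
    ∎
    where
    open ≡-Reasoning
    shuffle : ∀ a b c d → a + (b + 0) + (c + d) ≡ b + a + d + c
    shuffle = solve-∀
    new-open : counted' (nb , true) ≡ ⟦ eqZ o (A -ℤ 1ℤ) ∧ eqZ w B ⟧
    new-open = trans (newBlock true) (cong (λ u → ⟦ u ∧ eqZ w B ⟧)
                                           (trans (cong (λ u → eqZ u A) (+-comm o 1)) (sym (eqZ-pred o A))))
    new-closed : counted' (nb , false) ≡ ⟦ eqZ o A ∧ eqZ w B ⟧
    new-closed = trans (newBlock false) (cong (λ u → ⟦ eqZ u A ∧ eqZ w B ⟧) (+-identityʳ o))

sum-allMSP-suc : ∀ n (f : MSP → ℕ) →
                 sumL (allMSP (suc n)) f ≡ sumL (allMSP n) (λ λ₀ → sumL (choices n λ₀) (f ∘ extend n λ₀))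
sum-allMSP-suc n f = begin
    sumL (allMSP (suc n)) f
  ≡⟨ sumL-sameMembers f (unique-allMSP (suc n)) (unique-extensions n)
       (λ μ p → extensions-complete n μ (allMSP-∈⁻ (suc n) μ p)) (extensions-sound n) ⟩
    sumL (extensions n) f
  ≡⟨ sumL-concatMap (λ λ₀ → map (extend n λ₀) (choices n λ₀)) (allMSP n) f ⟩
    sumL (allMSP n) (λ λ₀ → sumL (map (extend n λ₀) (choices n λ₀)) f)
  ≡⟨ sumL-cong (allMSP n) (λ λ₀ _ → sumL-map (extend n λ₀) (choices n λ₀) f) ⟩
    sumL (allMSP n) (λ λ₀ → sumL (choices n λ₀) (f ∘ extend n λ₀))
  ∎
  where open ≡-Reasoning

sum-recurrenceTerms : ∀ n A B →
  sumL (allMSP n) (λ μ → recurrenceTerms (openBlocks n μ) (weight n μ) A B)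
  ≡ fi n A B + fi n (A -ℤ 1ℤ) B
    + sumZ A (λ j → fi n (A +ℤ 1ℤ) (B -ℤ j))
    + sumZ (A -ℤ 1ℤ) (λ j → fi n A (B -ℤ j))
sum-recurrenceTerms n A B = begin
    sumL L (λ μ → t₁ μ + t₂ μ + t₃ μ + t₄ μ)
  ≡⟨ trans (sumL-+ L _ t₄) (cong (_+ sumL L t₄) (trans (sumL-+ L _ t₃) (cong (_+ sumL L t₃) (sumL-+ L t₁ t₂)))) ⟩
    sumL L t₁ + sumL L t₂ + sumL L t₃ + sumL L t₄
  ≡⟨ sym (cong₂ _+_ (cong₂ _+_ (cong₂ _+_ (fi-as-sum n A B) (fi-as-sum n (A -ℤ 1ℤ) B))
                               (trans (sumZ-cong A (λ j → fi-as-sum n (A +ℤ 1ℤ) (B -ℤ j)))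
                                      (sumZ-sumL A L (λ j μ → ⟦ counted n (A +ℤ 1ℤ) (B -ℤ j) μ ⟧))))
                    (trans (sumZ-cong (A -ℤ 1ℤ) (λ j → fi-as-sum n A (B -ℤ j)))
                           (sumZ-sumL (A -ℤ 1ℤ) L (λ j μ → ⟦ counted n A (B -ℤ j) μ ⟧)))) ⟩
    fi n A B + fi n (A -ℤ 1ℤ) B + sumZ A (λ j → fi n (A +ℤ 1ℤ) (B -ℤ j)) + sumZ (A -ℤ 1ℤ) (λ j → fi n A (B -ℤ j))
  ∎
  where
  open ≡-Reasoning
  L = allMSP n
  t₁ t₂ t₃ t₄ : MSP → ℕ
  t₁ μ = ⟦ counted n A B μ ⟧
  t₂ μ = ⟦ counted n (A -ℤ 1ℤ) B μ ⟧
  t₃ μ = sumZ A (λ j → ⟦ counted n (A +ℤ 1ℤ) (B -ℤ j) μ ⟧)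
  t₄ μ = sumZ (A -ℤ 1ℤ) (λ j → ⟦ counted n A (B -ℤ j) μ ⟧)

theorem4p3 : (n : ℕ) (A B : ℤ) →
    fi (suc n) A B ≡
      fi n A B + fi n (A -ℤ 1ℤ) B
      + sumZ A (λ j → fi n (A +ℤ 1ℤ) (B -ℤ j))
      + sumZ (A -ℤ 1ℤ) (λ j → fi n A (B -ℤ j))
theorem4p3 n A B = begin
    fi (suc n) A B
  ≡⟨ fi-as-sum (suc n) A B ⟩
    sumL (allMSP (suc n)) (λ μ → ⟦ counted (suc n) A B μ ⟧)
  ≡⟨ sum-allMSP-suc n (λ μ → ⟦ counted (suc n) A B μ ⟧) ⟩
    sumL (allMSP n) (λ λ₀ → sumL (choices n λ₀) (λ c → ⟦ counted (suc n) A B (extend n λ₀ c) ⟧))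
  ≡⟨ sumL-cong (allMSP n) (λ { (ℓ , mk) p → Contribution.contribution n ℓ mk (allMSP-∈⁻ n (ℓ , mk) p) A B }) ⟩
    sumL (allMSP n) (λ μ → recurrenceTerms (openBlocks n μ) (weight n μ) A B)
  ≡⟨ sum-recurrenceTerms n A B ⟩
    fi n A B + fi n (A -ℤ 1ℤ) B + sumZ A (λ j → fi n (A +ℤ 1ℤ) (B -ℤ j)) + sumZ (A -ℤ 1ℤ) (λ j → fi n A (B -ℤ j))
  ∎
  where open ≡-Reasoning
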